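{- For any graph $G=(V,E)$ with a total ordering on its edges, any $q\ge2$ and any symmetric $q\times q$ matrix $A$, \[ F_G\big((w_T)_{T}\big)=H(G;x). \]
   Context: $J$ is the $q\times q$ all-ones matrix, $\hom(G,B)=\sum_{\phi:V\to[q]}\prod_{uv\in E}B_{\phi(u)\phi(v)}$, and $H(G;x)=q^{ -|V|}\hom(G,J+x(A-J))$. For a tree $T\subseteq E$ (edge set of a subtree of $G$ with $|T|\ge1$ edges and vertex set $V(T)$), let $E(V(T))_T$ be the set of broken edges of $T$ in $G[V(T)]$, where an edge $f\notin T$ is broken if $T\cup\{f\}$ contains a cycle in which $f$ is the largest edge. Define \[ w_T(x)=q^{ -(|T|+1)}\sum_{\phi:V(T)\to[q]}x^{|T|}\prod_{ij\in T}(A-J)_{\phi(i),\phi(j)}\prod_{ij\in E(V(T))_T}(J+x(A-J))_{\phi(i),\phi(j)}. \] Define $F_G\big((w_T)_T\big)=\sum_{F\in\mathcal{F}_G}\prod_{T\in\mathcal{C}(F)}w_T$, where $\mathcal{F}_G$ is the collection of edge sets $F\subseteq E$ forming forests (including $F=\emptyset$) and $\mathcal{C}(F)$ is the collection of (edge sets of) connected components of $(V,F)$ having at least one edge. -}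

module Defs where

open import Level using (Level)
open import Data.Nat using (ℕ; zero; suc)
import Data.Nat as N
open import Data.Fin using (Fin; zero; suc)
import Data.Fin as F
open import Data.Bool using (Bool; true; false; _∧_; _∨_; not; if_then_else_)
open import Data.Product using (_×_)
open import Data.Sum using (_⊎_)
open import Data.Maybe using (Maybe; just; nothing)
open import Algebra.Bundles using (CommutativeRing)
open import Relation.Binary.PropositionalEquality using (_≡_; _≢_)
open import Relation.Nullary.Decidable using (⌊_⌋)

anyFin : (k : ℕ) → (Fin k → Bool) → Bool
anyFin zero    p = false
anyFin (suc k) p = p zero ∨ anyFin k (λ i → p (suc i))

allFin : (k : ℕ) → (Fin k → Bool) → Bool
allFin zero    p = true
allFin (suc k) p = p zero ∧ allFin k (λ i → p (suc i))

_==_ : {k : ℕ} → Fin k → Fin k → Bool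
i == j = ⌊ i F.≟ j ⌋

_<ᵇ_ : {k : ℕ} → Fin k → Fin k → Bool
i <ᵇ j = ⌊ i F.<? j ⌋

count : (k : ℕ) → (Fin k → Bool) → ℕ
count zero    p = zero
count (suc k) p = (if p zero then 1 else 0) N.+ count k (λ i → p (suc i))

cons : {A : Set} {k : ℕ} → A → (Fin k → A) → Fin (suc k) → A
cons a φ zero    = a
cons a φ (suc i) = φ i

-- Finite simple graphs on vertex set Fin n with m edges.
-- Edge e : Fin m joins src e and tgt e; the total order on the edges
-- is the order of their indices in Fin m.

record Graph (n m : ℕ) : Set where
  field
    src tgt  : Fin m → Fin n
    loopless : ∀ e → src e ≢ tgt e
    simple   : ∀ e f →
               ((src e ≡ src f × tgt e ≡ tgt f) ⊎ (src e ≡ tgt f × tgt e ≡ src f)) →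
               e ≡ f

EdgeSet : ℕ → Set
EdgeSet m = Fin m → Bool

module GraphNotions {n m : ℕ} (G : Graph n m) where
  open Graph G

  adj : EdgeSet m → Fin n → Fin n → Bool
  adj S u v = anyFin m λ e → S e ∧ ((src e == u ∧ tgt e == v) ∨ (src e == v ∧ tgt e == u))

  reachWithin : ℕ → EdgeSet m → Fin n → Fin n → Bool
  reachWithin zero    S u v = u == v
  reachWithin (suc k) S u v = reachWithin k S u v ∨ anyFin n (λ w → reachWithin k S u w ∧ adj S w v)

  -- u, v in the same connected component of (V,S)
  -- (any path has at most n edges, so walks of length ≤ n suffice)
  connected : EdgeSet m → Fin n → Fin n → Bool
  connected S u v = reachWithin n S u v

  remove : EdgeSet m → Fin m → EdgeSet m
  remove S e f = S f ∧ not (f == e)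

  -- S contains a cycle iff some edge e ∈ S has its endpoints joined by a path in S ∖ {e}
  isForest : EdgeSet m → Bool
  isForest S = allFin m λ e → not (S e ∧ connected (remove S e) (src e) (tgt e))

  component : EdgeSet m → Fin m → EdgeSet m
  component S e f = S f ∧ connected S (src f) (src e)

  -- e is the smallest edge of its component (one representative per component)
  isRep : EdgeSet m → Fin m → Bool
  isRep S e = S e ∧ allFin m (λ f → not ((f <ᵇ e) ∧ component S e f))

  vertexSet : EdgeSet m → Fin n → Bool
  vertexSet T v = anyFin m λ e → T e ∧ (src e == v ∨ tgt e == v)

  below : EdgeSet m → Fin m → EdgeSet m
  below T f e = T e ∧ (e <ᵇ f)

  -- f ∉ T is broken for T: T ∪ {f} has a cycle in which f is the largest edge,
  -- i.e. the endpoints of f are joined by a path using only edges of T smaller than f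
  broken : EdgeSet m → Fin m → Bool
  broken T f = not (T f) ∧ connected (below T f) (src f) (tgt f)

  brokenInduced : EdgeSet m → Fin m → Bool
  brokenInduced T f = vertexSet T (src f) ∧ vertexSet T (tgt f) ∧ broken T f

module RingNotions {c ℓ : Level} (R : CommutativeRing c ℓ) where
  open CommutativeRing R hiding (zero)

  sumFin : (k : ℕ) → (Fin k → Carrier) → Carrier
  sumFin zero    f = 0#
  sumFin (suc k) f = f zero + sumFin k (λ i → f (suc i))

  prodFin : (k : ℕ) → (Fin k → Carrier) → Carrier
  prodFin zero    f = 1#
  prodFin (suc k) f = f zero * prodFin k (λ i → f (suc i))

  infixr 8 _^ᴿ_
  _^ᴿ_ : Carrier → ℕ → Carrier
  x ^ᴿ zero  = 1#
  x ^ᴿ suc k = x * x ^ᴿ k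

  fromℕ : ℕ → Carrier
  fromℕ zero    = 0#
  fromℕ (suc k) = 1# + fromℕ k

  sumMaps : (n q : ℕ) → ((Fin n → Fin q) → Carrier) → Carrier
  sumMaps zero    q f = f (λ ())
  sumMaps (suc n) q f = sumFin q λ a → sumMaps n q (λ φ → f (cons a φ))

  -- sum over all maps φ : S → Fin q for S ⊆ Fin n, represented as
  -- partial maps defined (just) exactly on S
  sumMapsOn : (n q : ℕ) → (Fin n → Bool) → ((Fin n → Maybe (Fin q)) → Carrier) → Carrier
  sumMapsOn zero    q S f = f (λ ())
  sumMapsOn (suc n) q S f =
    if S zero
    then sumFin q (λ a → sumMapsOn n q (λ i → S (suc i)) (λ φ → f (cons (just a) φ)))
    else sumMapsOn n q (λ i → S (suc i)) (λ φ → f (cons nothing φ))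

  Mat : ℕ → Set c
  Mat q = Fin q → Fin q → Carrier

  -- entry of a matrix at a pair of (defined) colours; the junk value 0#
  -- is never used since all relevant vertices lie in the domain
  entry : {q : ℕ} → Mat q → Maybe (Fin q) → Maybe (Fin q) → Carrier
  entry B (just a) (just b) = B a b
  entry B _        _        = 0#

  A-J : {q : ℕ} → Mat q → Mat q
  A-J A a b = A a b - 1#

  Jx : {q : ℕ} → Carrier → Mat q → Mat q
  Jx x A a b = 1# + x * (A a b - 1#)

  module _ {n m : ℕ} (G : Graph n m) where
    open Graph G
    open GraphNotions G

    prodOver : EdgeSet m → (Fin m → Carrier) → Carrier
    prodOver S g = prodFin m (λ e → if S e then g e else 1#)

    hom : {q : ℕ} → Mat q → Carrier
    hom {q} B = sumMaps n q λ φ → prodFin m λ e → B (φ (src e)) (φ (tgt e))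

    H : (q : ℕ) → (qinv : Carrier) → Mat q → Carrier → Carrier
    H q qinv A x = qinv ^ᴿ n * hom (Jx x A)

    w : (q : ℕ) → (qinv : Carrier) → Mat q → Carrier → EdgeSet m → Carrier
    w q qinv A x T =
      qinv ^ᴿ (count m T N.+ 1) *
      sumMapsOn n q (vertexSet T) (λ φ →
        x ^ᴿ count m T
        * prodOver T (λ e → entry (A-J A) (φ (src e)) (φ (tgt e)))
        * prodOver (brokenInduced T) (λ e → entry (Jx x A) (φ (src e)) (φ (tgt e))))

    sumSubsets : (k : ℕ) → ((Fin k → Bool) → Carrier) → Carrier
    sumSubsets zero    f = f (λ ())
    sumSubsets (suc k) f = f' true + f' false
      where f' : Bool → Carrier
            f' b = sumSubsets k (λ S → f (cons b S))

    FG : (EdgeSet m → Carrier) → Carrier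
    FG wt = sumSubsets m λ F →
      if isForest F
      then prodOver (isRep F) (λ e → wt (component F e))
      else 0#

{-# OPTIONS --safe #-}
-- Writing J + x(A - J) = 1 + y entrywise, with y_e(φ) = x (A_{φ(u)φ(v)} - 1) for
-- an edge e = uv, H(G;x) is the average over colourings φ of ∏_e (1 + y_e).  The
-- broken-circuit expansion
--   ∏_e (1 + y_e) = Σ_{F forest} ∏_{e ∈ F} y_e ∏_{f broken for F} (1 + y_f)
-- holds for any y, by induction on the number of edges, deleting the largest one:
-- adding it to a forest either closes a cycle, and then it is broken for that
-- forest, or gives a new forest, and it breaks no other edge.  For a fixed forest
-- the broken edges split among its trees, the trees are vertex-disjoint, and a
-- tree with k edges has k + 1 vertices; so the average of the summand factorises
-- over the trees into exactly the weights w_T.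
module Submission where

open import Level using (Level)
open import Data.Nat as Nat using (ℕ; zero; suc; _≤_)
import Data.Nat.Properties as ℕₚ
open import Data.Fin as Fin using (Fin; zero; suc; toℕ; inject₁)
import Data.Fin.Properties as Finₚ
open import Data.Bool using (Bool; true; false; _∧_; _∨_; not; if_then_else_)
open import Data.Bool.Properties using (not-¬; ¬-not; not-injective; ∧-zeroʳ; ∧-identityʳ; ∨-identityʳ)
open import Data.Maybe using (Maybe; just; nothing)
open import Data.Product using (∃-syntax; _×_; _,_; proj₁; proj₂)
open import Data.Sum using (_⊎_; inj₁; inj₂)
open import Data.Empty using (⊥; ⊥-elim)
open import Relation.Nullary using (¬_; yes; no)
open import Relation.Binary.Definitions using (tri<; tri≈; tri>)
open import Relation.Binary.PropositionalEquality as ≡ using (_≡_; _≢_; _≗_)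
open import Algebra.Bundles using (CommutativeRing)
import Algebra.Properties.CommutativeMonoid.Sum as MonoidSum
import Algebra.Properties.Semiring.Sum as SemiringSum
import Algebra.Properties.CommutativeSemigroup as CommSemigroupProps
open import Defs

module Combinatorics where
  open Nat using (_+_; _∸_; _<_; z≤n; s≤s)
  open import Data.Fin using (fromℕ)
  open ≡ using (refl; sym; trans; cong; cong₂; subst; subst₂; module ≡-Reasoning)

  ∧-elim : ∀ {a b} → a ∧ b ≡ true → a ≡ true × b ≡ true
  ∧-elim {true}  {true}  _  = refl , refl
  ∧-elim {true}  {false} ()
  ∧-elim {false}         ()

  ∧-intro : ∀ {a b} → a ≡ true → b ≡ true → a ∧ b ≡ true
  ∧-intro refl refl = refl

  ∨-elim : ∀ {a b} → a ∨ b ≡ true → a ≡ true ⊎ b ≡ true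
  ∨-elim {true}  _   = inj₁ refl
  ∨-elim {false} b≡t = inj₂ b≡t

  ∨-introˡ : ∀ {a} b → a ≡ true → a ∨ b ≡ true
  ∨-introˡ b refl = refl

  ∨-introʳ : ∀ a {b} → b ≡ true → a ∨ b ≡ true
  ∨-introʳ true  _   = refl
  ∨-introʳ false b≡t = b≡t

  not-elim : ∀ {a} → not a ≡ true → a ≡ false
  not-elim {false} _ = refl

  not-intro : ∀ {a} → a ≡ false → not a ≡ true
  not-intro refl = refl

  true-⇔⇒≡ : ∀ {a b} → (a ≡ true → b ≡ true) → (b ≡ true → a ≡ true) → a ≡ b
  true-⇔⇒≡ {true}  {true}  _ _ = refl
  true-⇔⇒≡ {true}  {false} f _ = sym (f refl)
  true-⇔⇒≡ {false} {true}  _ g = g refl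
  true-⇔⇒≡ {false} {false} _ _ = refl

  ==⇒≡ : ∀ {k} {i j : Fin k} → (i == j) ≡ true → i ≡ j
  ==⇒≡ {i = i} {j} i==j with i Fin.≟ j
  ... | yes i≡j = i≡j

  ≡⇒== : ∀ {k} {i j : Fin k} → i ≡ j → (i == j) ≡ true
  ≡⇒== {i = i} {j} i≡j with i Fin.≟ j
  ... | yes _   = refl
  ... | no i≢j = ⊥-elim (i≢j i≡j)

  ≢⇒==false : ∀ {k} {i j : Fin k} → i ≢ j → (i == j) ≡ false
  ≢⇒==false {i = i} {j} i≢j with i Fin.≟ j
  ... | yes i≡j = ⊥-elim (i≢j i≡j)
  ... | no _    = refl

  <ᵇ⇒< : ∀ {k} {i j : Fin k} → (i <ᵇ j) ≡ true → i Fin.< j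
  <ᵇ⇒< {i = i} {j} i<ᵇj with i Fin.<? j
  ... | yes i<j = i<j

  <⇒<ᵇ : ∀ {k} {i j : Fin k} → i Fin.< j → (i <ᵇ j) ≡ true
  <⇒<ᵇ {i = i} {j} i<j with i Fin.<? j
  ... | yes _   = refl
  ... | no i≮j = ⊥-elim (i≮j i<j)

  ≮⇒<ᵇfalse : ∀ {k} {i j : Fin k} → ¬ (i Fin.< j) → (i <ᵇ j) ≡ false
  ≮⇒<ᵇfalse {i = i} {j} i≮j with i Fin.<? j
  ... | yes i<j = ⊥-elim (i≮j i<j)
  ... | no _    = refl

  _⊆_ : ∀ {k} → (Fin k → Bool) → (Fin k → Bool) → Set
  p ⊆ q = ∀ i → p i ≡ true → q i ≡ true

  anyFin⇒∃ : ∀ k {p : Fin k → Bool} → anyFin k p ≡ true → ∃[ i ] p i ≡ true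
  anyFin⇒∃ (suc k) {p} any with p zero in p0
  ... | true  = zero , p0
  ... | false = let i , pi = anyFin⇒∃ k any in suc i , pi

  ∃⇒anyFin : ∀ k {p : Fin k → Bool} i → p i ≡ true → anyFin k p ≡ true
  ∃⇒anyFin (suc k) zero    pi rewrite pi = refl
  ∃⇒anyFin (suc k) {p} (suc i) pi = ∨-introʳ (p zero) (∃⇒anyFin k i pi)

  ¬anyFin⇒∀ : ∀ k {p : Fin k → Bool} → anyFin k p ≡ false → ∀ i → p i ≡ false
  ¬anyFin⇒∀ k none i = ¬-not λ pi → not-¬ (∃⇒anyFin k i pi) none

  allFin⇒∀ : ∀ k {p : Fin k → Bool} → allFin k p ≡ true → ∀ i → p i ≡ true
  allFin⇒∀ (suc k) all zero    = proj₁ (∧-elim all)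
  allFin⇒∀ (suc k) {p} all (suc i) = allFin⇒∀ k (proj₂ (∧-elim {p zero} all)) i

  ∀⇒allFin : ∀ k {p : Fin k → Bool} → (∀ i → p i ≡ true) → allFin k p ≡ true
  ∀⇒allFin zero    _   = refl
  ∀⇒allFin (suc k) all = ∧-intro (all zero) (∀⇒allFin k (λ i → all (suc i)))

  ¬allFin⇒∃ : ∀ k {p : Fin k → Bool} → allFin k p ≡ false → ∃[ i ] p i ≡ false
  ¬allFin⇒∃ (suc k) {p} notAll with p zero in p0
  ... | false = zero , p0
  ... | true  = let i , pi = ¬allFin⇒∃ k notAll in suc i , pi

  allFin-cong : ∀ k {p q : Fin k → Bool} → p ≗ q → allFin k p ≡ allFin k q
  allFin-cong zero    _   = refl
  allFin-cong (suc k) p≗q = cong₂ _∧_ (p≗q zero) (allFin-cong k (λ i → p≗q (suc i)))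

  [_]ℕ : Bool → ℕ
  [ b ]ℕ = if b then 1 else 0

  count-cong : ∀ k {p q : Fin k → Bool} → p ≗ q → count k p ≡ count k q
  count-cong zero    _   = refl
  count-cong (suc k) p≗q = cong₂ (λ b c → [ b ]ℕ + c) (p≗q zero) (count-cong k (λ i → p≗q (suc i)))

  count≤ : ∀ k (p : Fin k → Bool) → count k p ≤ k
  count≤ zero    p = z≤n
  count≤ (suc k) p with p zero
  ... | true  = s≤s (count≤ k _)
  ... | false = ℕₚ.m≤n⇒m≤1+n (count≤ k _)

  count-mono : ∀ k {p q : Fin k → Bool} → p ⊆ q → count k p ≤ count k q
  count-mono zero    _   = z≤n
  count-mono (suc k) {p} {q} p⊆q with p zero in p0 | q zero in q0
  ... | true  | true  = s≤s (count-mono k (λ i → p⊆q (suc i)))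
  ... | true  | false = ⊥-elim (not-¬ (p⊆q zero p0) q0)
  ... | false | true  = ℕₚ.m≤n⇒m≤1+n (count-mono k (λ i → p⊆q (suc i)))
  ... | false | false = count-mono k (λ i → p⊆q (suc i))

  count-mono-< : ∀ k {p q : Fin k → Bool} → p ⊆ q → ∀ j → q j ≡ true → p j ≡ false → count k p < count k q
  count-mono-< (suc k) {p} {q} p⊆q zero qj pj rewrite qj | pj = s≤s (count-mono k (λ i → p⊆q (suc i)))
  count-mono-< (suc k) {p} {q} p⊆q (suc j) qj pj with p zero in p0 | q zero in q0
  ... | true  | true  = s≤s (count-mono-< k (λ i → p⊆q (suc i)) j qj pj)
  ... | true  | false = ⊥-elim (not-¬ (p⊆q zero p0) q0)
  ... | false | true  = ℕₚ.m≤n⇒m≤1+n (count-mono-< k (λ i → p⊆q (suc i)) j qj pj)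
  ... | false | false = count-mono-< k (λ i → p⊆q (suc i)) j qj pj

  count-none : ∀ k {p : Fin k → Bool} → (∀ i → p i ≡ false) → count k p ≡ 0
  count-none zero    _    = refl
  count-none (suc k) none rewrite none zero = count-none k (λ i → none (suc i))

  count-pos : ∀ k {p : Fin k → Bool} j → p j ≡ true → 0 < count k p
  count-pos k {p} j pj =
    subst (_< count k p) (count-none k {λ _ → false} (λ _ → refl)) (count-mono-< k (λ _ ()) j pj refl)

  count-single : ∀ k {p : Fin k → Bool} j → p j ≡ true → (∀ i → p i ≡ true → i ≡ j) → count k p ≡ 1
  count-single (suc k) zero pj only rewrite pj =
    cong suc (count-none k (λ i → ¬-not λ pi → Finₚ.0≢1+n (sym (only (suc i) pi))))
  count-single (suc k) {p} (suc j) pj only with p zero in p0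
  ... | true  = ⊥-elim (Finₚ.0≢1+n (only zero p0))
  ... | false = count-single k j pj (λ i pi → Finₚ.suc-injective (only (suc i) pi))

  count-∨+count-∧ : ∀ k (p q : Fin k → Bool) →
    count k p + count k q ≡ count k (λ i → p i ∨ q i) + count k (λ i → p i ∧ q i)
  count-∨+count-∧ zero    p q = refl
  count-∨+count-∧ (suc k) p q with p zero | q zero
  ... | true  | true  =
    cong suc (trans (ℕₚ.+-suc _ _) (trans (cong suc (count-∨+count-∧ k _ _)) (sym (ℕₚ.+-suc _ _))))
  ... | true  | false = cong suc (count-∨+count-∧ k _ _)
  ... | false | true  = trans (ℕₚ.+-suc _ _) (cong suc (count-∨+count-∧ k _ _))
  ... | false | false = count-∨+count-∧ k _ _

  count-disjoint-∨ : ∀ k {p q r : Fin k → Bool} → (∀ i → r i ≡ (p i ∨ q i)) →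
    (∀ i → p i ≡ true → q i ≡ true → ⊥) → count k r ≡ count k p + count k q
  count-disjoint-∨ k {p} {q} {r} r≗p∨q disjoint = begin
    count k r
      ≡⟨ count-cong k r≗p∨q ⟩
    count k (λ i → p i ∨ q i)
      ≡⟨ ℕₚ.+-identityʳ _ ⟨
    count k (λ i → p i ∨ q i) + 0
      ≡⟨ cong (count k (λ i → p i ∨ q i) +_) (count-none k p∧q-false) ⟨
    count k (λ i → p i ∨ q i) + count k (λ i → p i ∧ q i)
      ≡⟨ count-∨+count-∧ k p q ⟨
    count k p + count k q ∎
    where
    open ≡-Reasoning
    p∧q-false : ∀ i → (p i ∧ q i) ≡ false
    p∧q-false i = ¬-not λ both → let pi , qi = ∧-elim both in disjoint i pi qi

  IsLeast : ∀ {k} → (Fin k → Bool) → Fin k → Bool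
  IsLeast {k} p e = p e ∧ allFin k (λ g → not (g <ᵇ e ∧ p g))

  IsLeast-unique : ∀ {k} (p : Fin k → Bool) {e e′} → IsLeast p e ≡ true → IsLeast p e′ ≡ true → e ≡ e′
  IsLeast-unique {k} p {e} {e′} least least′ with ℕₚ.<-cmp (toℕ e) (toℕ e′)
  ... | tri< e<e′ _ _ = ⊥-elim (not-¬ (∧-intro (<⇒<ᵇ e<e′) (proj₁ (∧-elim least)))
                                    (not-elim (allFin⇒∀ k (proj₂ (∧-elim {p e′} least′)) e)))
  ... | tri≈ _ e≡e′ _ = Finₚ.toℕ-injective e≡e′
  ... | tri> _ _ e′<e = ⊥-elim (not-¬ (∧-intro (<⇒<ᵇ e′<e) (proj₁ (∧-elim least′)))
                                    (not-elim (allFin⇒∀ k (proj₂ (∧-elim {p e} least)) e′)))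

  IsLeast-exists : ∀ {k} (p : Fin k → Bool) i → p i ≡ true → ∃[ e ] IsLeast p e ≡ true
  IsLeast-exists {k} p i = descend k i (Finₚ.toℕ<n i)
    where
    descend : ∀ fuel i → toℕ i < fuel → p i ≡ true → ∃[ e ] IsLeast p e ≡ true
    descend (suc fuel) i i<fuel pi with allFin k (λ g → not (g <ᵇ i ∧ p g)) in noneBelow
    ... | true  = i , ∧-intro pi noneBelow
    ... | false with ¬allFin⇒∃ k noneBelow
    ...   | g , below with ∧-elim (not-injective {y = true} below)
    ...     | g<i , pg = descend fuel g (ℕₚ.<-≤-trans (<ᵇ⇒< g<i) (ℕₚ.≤-pred i<fuel)) pg

  count-IsLeast : ∀ k (p : Fin k → Bool) → count k (IsLeast p) ≡ [ anyFin k p ]ℕ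
  count-IsLeast k p with anyFin k p in any
  ... | true  = let i , pi = anyFin⇒∃ k any ; e , least = IsLeast-exists p i pi in
    count-single k e least (λ e′ least′ → IsLeast-unique p least′ least)
  ... | false = count-none k (λ i → ¬-not λ least → not-¬ (proj₁ (∧-elim least)) (¬anyFin⇒∀ k any i))

  infixl 5 _∷ʳ_
  _∷ʳ_ : ∀ {A : Set} {k} → (Fin k → A) → A → Fin (suc k) → A
  _∷ʳ_ {k = zero}  ρ b zero    = b
  _∷ʳ_ {k = suc k} ρ b zero    = ρ zero
  _∷ʳ_ {k = suc k} ρ b (suc i) = ((λ j → ρ (suc j)) ∷ʳ b) i

  ∷ʳ-inject₁ : ∀ {A : Set} {k} (ρ : Fin k → A) b i → (ρ ∷ʳ b) (inject₁ i) ≡ ρ i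
  ∷ʳ-inject₁ {k = suc k} ρ b zero    = refl
  ∷ʳ-inject₁ {k = suc k} ρ b (suc i) = ∷ʳ-inject₁ (λ j → ρ (suc j)) b i

  ∷ʳ-last : ∀ {A : Set} {k} (ρ : Fin k → A) b → (ρ ∷ʳ b) (fromℕ k) ≡ b
  ∷ʳ-last {k = zero}  ρ b = refl
  ∷ʳ-last {k = suc k} ρ b = ∷ʳ-last (λ j → ρ (suc j)) b

  inject₁-or-last : ∀ {k} (e : Fin (suc k)) → (∃[ i ] e ≡ inject₁ i) ⊎ e ≡ fromℕ k
  inject₁-or-last {zero}  zero    = inj₂ refl
  inject₁-or-last {suc k} zero    = inj₁ (zero , refl)
  inject₁-or-last {suc k} (suc e) with inject₁-or-last e
  ... | inj₁ (i , refl) = inj₁ (suc i , refl)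
  ... | inj₂ refl       = inj₂ refl

  inject₁-<ᵇ : ∀ {k} (i j : Fin k) → (inject₁ i <ᵇ inject₁ j) ≡ (i <ᵇ j)
  inject₁-<ᵇ i j = true-⇔⇒≡
    (λ lt → <⇒<ᵇ (subst₂ _<_ (Finₚ.toℕ-inject₁ i) (Finₚ.toℕ-inject₁ j) (<ᵇ⇒< lt)))
    (λ lt → <⇒<ᵇ (subst₂ _<_ (sym (Finₚ.toℕ-inject₁ i)) (sym (Finₚ.toℕ-inject₁ j)) (<ᵇ⇒< lt)))

  inject₁<last : ∀ {k} (i : Fin k) → inject₁ i Fin.< fromℕ k
  inject₁<last {k} i = subst (toℕ (inject₁ i) <_) (sym (Finₚ.toℕ-fromℕ k)) (Finₚ.inject₁ℕ< i)

  inject₁-== : ∀ {k} (i j : Fin k) → (inject₁ i == inject₁ j) ≡ (i == j)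
  inject₁-== i j = true-⇔⇒≡ (λ eq → ≡⇒== (Finₚ.inject₁-injective (==⇒≡ eq)))
                            (λ eq → ≡⇒== (cong inject₁ (==⇒≡ eq)))

  inject₁-==-last : ∀ {k} (i : Fin k) → (inject₁ i == fromℕ k) ≡ false
  inject₁-==-last i = ≢⇒==false (λ eq → Finₚ.fromℕ≢inject₁ (sym eq))

  cons-cong : ∀ {A : Set} {k} (a : A) {ψ ψ′ : Fin k → A} → ψ ≗ ψ′ → cons a ψ ≗ cons a ψ′
  cons-cong a ψ≗ψ′ zero    = refl
  cons-cong a ψ≗ψ′ (suc i) = ψ≗ψ′ i

  module Walks {n m : ℕ} (G : Graph n m) where
    open Graph G
    open GraphNotions G

    Joins : Fin m → Fin n → Fin n → Set
    Joins e v w = (src e ≡ v × tgt e ≡ w) ⊎ (src e ≡ w × tgt e ≡ v)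

    Step : EdgeSet m → Fin n → Fin n → Set
    Step S v w = ∃[ e ] S e ≡ true × Joins e v w

    infixl 5 _▷_
    data Path (S : EdgeSet m) (u : Fin n) : Fin n → Set where
      []  : Path S u u
      _▷_ : ∀ {v w} → Path S u v → Step S v w → Path S u w

    length : ∀ {S u v} → Path S u v → ℕ
    length []      = zero
    length (p ▷ _) = suc (length p)

    Joins-sym : ∀ {e v w} → Joins e v w → Joins e w v
    Joins-sym (inj₁ ends) = inj₂ ends
    Joins-sym (inj₂ ends) = inj₁ ends

    Step-sym : ∀ {S v w} → Step S v w → Step S w v
    Step-sym (e , Se , ends) = e , Se , Joins-sym ends

    edgeStep : ∀ {S} e → S e ≡ true → Step S (src e) (tgt e)
    edgeStep e Se = e , Se , inj₁ (refl , refl)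

    infixr 5 _◁_
    _◁_ : ∀ {S u u′ v} → Step S u u′ → Path S u′ v → Path S u v
    s ◁ []      = [] ▷ s
    s ◁ (p ▷ t) = (s ◁ p) ▷ t

    infixl 5 _++ₚ_
    _++ₚ_ : ∀ {S u v w} → Path S u v → Path S v w → Path S u w
    p ++ₚ []      = p
    p ++ₚ (q ▷ s) = (p ++ₚ q) ▷ s

    reverseₚ : ∀ {S u v} → Path S u v → Path S v u
    reverseₚ []      = []
    reverseₚ (p ▷ s) = Step-sym s ◁ reverseₚ p

    Path-mono : ∀ {S S′ u v} → S ⊆ S′ → Path S u v → Path S′ u v
    Path-mono S⊆S′ []                    = []
    Path-mono S⊆S′ (p ▷ (e , Se , ends)) = Path-mono S⊆S′ p ▷ (e , S⊆S′ e Se , ends)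

    Path-cong : ∀ {S S′ u v} → S ≗ S′ → Path S u v → Path S′ u v
    Path-cong S≗S′ = Path-mono (λ e Se → trans (sym (S≗S′ e)) Se)

    lastEdge : ∀ {S u v} → Path S u v →
      v ≡ u ⊎ ∃[ g ] S g ≡ true × Path S u (src g) × (src g ≡ v ⊎ tgt g ≡ v)
    lastEdge []                                      = inj₁ refl
    lastEdge (p ▷ (g , Sg , inj₁ (refl , tg≡w)))      = inj₂ (g , Sg , p , inj₂ tg≡w)
    lastEdge (p ▷ s@(g , Sg , inj₂ (refl , refl)))   = inj₂ (g , Sg , p ▷ s , inj₁ refl)

    adj⇒Step : ∀ {S v w} → adj S v w ≡ true → Step S v w
    adj⇒Step {S} {v} {w} a with anyFin⇒∃ m a
    ... | e , Se∧ends with ∧-elim {S e} Se∧ends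
    ...   | Se , ends with ∨-elim {src e == v ∧ tgt e == w} ends
    ...     | inj₁ fw = let s , t = ∧-elim fw in e , Se , inj₁ (==⇒≡ s , ==⇒≡ t)
    ...     | inj₂ bw = let s , t = ∧-elim bw in e , Se , inj₂ (==⇒≡ s , ==⇒≡ t)

    Step⇒adj : ∀ {S v w} → Step S v w → adj S v w ≡ true
    Step⇒adj (e , Se , inj₁ (s , t)) = ∃⇒anyFin m e (∧-intro Se (∨-introˡ _ (∧-intro (≡⇒== s) (≡⇒== t))))
    Step⇒adj {v = v} {w} (e , Se , inj₂ (s , t)) =
      ∃⇒anyFin m e (∧-intro Se (∨-introʳ (src e == v ∧ tgt e == w) (∧-intro (≡⇒== s) (≡⇒== t))))

    reachWithin⇒Path : ∀ k {S u v} → reachWithin k S u v ≡ true → Path S u v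
    reachWithin⇒Path zero    r rewrite ==⇒≡ r = []
    reachWithin⇒Path (suc k) {S} {u} {v} r with ∨-elim {reachWithin k S u v} r
    ... | inj₁ r′ = reachWithin⇒Path k r′
    ... | inj₂ r′ with anyFin⇒∃ n r′
    ...   | w , rw∧a = let rw , a = ∧-elim rw∧a in reachWithin⇒Path k rw ▷ adj⇒Step a

    Path⇒reachWithin : ∀ {S u v} (p : Path S u v) → reachWithin (length p) S u v ≡ true
    Path⇒reachWithin []                  = ≡⇒== refl
    Path⇒reachWithin {S} {u} (_▷_ {v} {w} p s) =
      ∨-introʳ (reachWithin (length p) S u w) (∃⇒anyFin n v (∧-intro (Path⇒reachWithin p) (Step⇒adj s)))

    -- The sets reachable within k steps grow strictly until they stop growing
    -- for good; having at most n elements, they have stabilised after n steps.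
    module Saturation (S : EdgeSet m) (u : Fin n) where
      Reach : ℕ → Fin n → Bool
      Reach k = reachWithin k S u

      Reach-step : ∀ k → Reach k ⊆ Reach (suc k)
      Reach-step k v r = ∨-introˡ _ r

      Reach-mono : ∀ j k → Reach k ⊆ Reach (j + k)
      Reach-mono zero    k v r = r
      Reach-mono (suc j) k v r = Reach-step (j + k) v (Reach-mono j k v r)

      Stable : ℕ → Set
      Stable k = Reach (suc k) ⊆ Reach k

      Stable-suc : ∀ k → Stable k → Stable (suc k)
      Stable-suc k stable v r with ∨-elim {Reach (suc k) v} r
      ... | inj₁ r′ = r′
      ... | inj₂ r′ with anyFin⇒∃ n r′
      ...   | w , rw∧a = let rw , a = ∧-elim rw∧a in
        ∨-introʳ (Reach k v) (∃⇒anyFin n w (∧-intro (stable w rw) a))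

      Stable-+ : ∀ j k → Stable k → Stable (j + k)
      Stable-+ zero    k stable = stable
      Stable-+ (suc j) k stable = Stable-suc (j + k) (Stable-+ j k stable)

      Stable-reach : ∀ j k → Stable k → Reach (j + k) ⊆ Reach k
      Stable-reach zero    k stable v r = r
      Stable-reach (suc j) k stable v r = Stable-reach j k stable v (Stable-+ j k stable v r)

      grows-or-stable : ∀ k → k < count n (Reach k) ⊎ Stable k
      grows-or-stable zero = inj₁ (count-pos n u (≡⇒== refl))
      grows-or-stable (suc k) with grows-or-stable k
      ... | inj₂ stable = inj₂ (Stable-suc k stable)
      ... | inj₁ grown with allFin n (λ v → not (Reach (suc k) v) ∨ Reach k v) in noNew
      ...   | true  = inj₂ (Stable-suc k λ v r → implies (allFin⇒∀ n noNew v) r)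
        where
        implies : ∀ {a b} → (not a ∨ b) ≡ true → a ≡ true → b ≡ true
        implies {true} b refl = b
      ...   | false with ¬allFin⇒∃ n noNew
      ...     | v , new = inj₁ (ℕₚ.<-≤-trans (s≤s grown)
                                 (count-mono-< n (Reach-step k) v (newIn new) (newNotIn new)))
        where
        newIn : ∀ {a b} → (not a ∨ b) ≡ false → a ≡ true
        newIn {true} _ = refl
        newNotIn : ∀ {a b} → (not a ∨ b) ≡ false → b ≡ false
        newNotIn {true} {false} _ = refl

      stable-at-n : Stable n
      stable-at-n with grows-or-stable n
      ... | inj₂ stable = stable
      ... | inj₁ grown  = ⊥-elim (ℕₚ.<⇒≱ grown (count≤ n (Reach n)))

      Reach⊆Reach-n : ∀ k → Reach k ⊆ Reach n
      Reach⊆Reach-n k v r with ℕₚ.≤-total k n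
      ... | inj₁ k≤n = subst (λ j → Reach j v ≡ true) (ℕₚ.m∸n+n≡m k≤n) (Reach-mono (n ∸ k) k v r)
      ... | inj₂ n≤k = Stable-reach (k ∸ n) n stable-at-n v
                         (subst (λ j → Reach j v ≡ true) (sym (ℕₚ.m∸n+n≡m n≤k)) r)

    connected⇒Path : ∀ {S u v} → connected S u v ≡ true → Path S u v
    connected⇒Path = reachWithin⇒Path n

    Path⇒connected : ∀ {S u v} → Path S u v → connected S u v ≡ true
    Path⇒connected {S} {u} {v} p = Saturation.Reach⊆Reach-n S u (length p) v (Path⇒reachWithin p)

    connected-sym : ∀ S u v → connected S u v ≡ connected S v u
    connected-sym S u v = true-⇔⇒≡ (λ c → Path⇒connected (reverseₚ (connected⇒Path c)))
                                   (λ c → Path⇒connected (reverseₚ (connected⇒Path c)))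

    connected-cong : ∀ {S S′} → S ≗ S′ → ∀ u v → connected S u v ≡ connected S′ u v
    connected-cong S≗S′ u v = true-⇔⇒≡ (λ c → Path⇒connected (Path-cong S≗S′ (connected⇒Path c)))
                                       (λ c → Path⇒connected (Path-cong (λ e → sym (S≗S′ e)) (connected⇒Path c)))

    remove-⊆ : ∀ F f → remove F f ⊆ F
    remove-⊆ F f e r = proj₁ (∧-elim r)

    remove-self : ∀ F f → remove F f f ≡ false
    remove-self F f rewrite ≡⇒== {i = f} refl = ∧-zeroʳ (F f)

    Forest : EdgeSet m → Set
    Forest F = ∀ e → F e ≡ true → ¬ Path (remove F e) (src e) (tgt e)

    isForest⇒Forest : ∀ {F} → isForest F ≡ true → Forest F
    isForest⇒Forest isF e Fe p = not-¬ (∧-intro Fe (Path⇒connected p)) (not-elim (allFin⇒∀ m isF e))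

    Forest⇒isForest : ∀ {F} → Forest F → isForest F ≡ true
    Forest⇒isForest forest = ∀⇒allFin m λ e → not-intro (¬-not λ cyc →
      let Fe , c = ∧-elim cyc in forest e Fe (connected⇒Path c))

    Forest-antimono : ∀ {F F′} → F′ ⊆ F → Forest F → Forest F′
    Forest-antimono F′⊆F forest e F′e p =
      forest e (F′⊆F e F′e) (Path-mono (λ g r → let F′g , g≢e = ∧-elim r in ∧-intro (F′⊆F g F′g) g≢e) p)

    isForest-cong : ∀ {F F′} → F ≗ F′ → isForest F ≡ isForest F′
    isForest-cong F≗F′ = true-⇔⇒≡
      (λ isF → Forest⇒isForest (Forest-antimono (λ e F′e → trans (F≗F′ e) F′e) (isForest⇒Forest isF)))
      (λ isF → Forest⇒isForest (Forest-antimono (λ e Fe → trans (sym (F≗F′ e)) Fe) (isForest⇒Forest isF)))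

    PathVia : EdgeSet m → Fin m → Fin n → Fin n → Set
    PathVia F f x y = Path F∖f x y
                    ⊎ (Path F∖f x (src f) × Path F∖f (tgt f) y)
                    ⊎ (Path F∖f x (tgt f) × Path F∖f (src f) y)
      where
      F∖f : EdgeSet m
      F∖f = remove F f

    splitAt : ∀ F f {x y} → Path F x y → PathVia F f x y
    splitAt F f []                     = inj₁ []
    splitAt F f {x} (_▷_ {v} {w} p (g , Fg , ends)) with g Fin.≟ f | splitAt F f p
    ... | no g≢f | via = extend via
      where
      s : Step (remove F f) v w
      s = g , ∧-intro Fg (not-intro (≢⇒==false g≢f)) , ends
      extend : PathVia F f x v → PathVia F f x w
      extend (inj₁ q)                = inj₁ (q ▷ s)
      extend (inj₂ (inj₁ (q₁ , q₂))) = inj₂ (inj₁ (q₁ , q₂ ▷ s))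
      extend (inj₂ (inj₂ (q₁ , q₂))) = inj₂ (inj₂ (q₁ , q₂ ▷ s))
    ... | yes refl | via with ends
    ...   | inj₁ (refl , refl) = forward via
      where
      forward : PathVia F f x (src f) → PathVia F f x (tgt f)
      forward (inj₁ q)                = inj₂ (inj₁ (q , []))
      forward (inj₂ (inj₁ (q₁ , q₂))) = inj₁ (q₁ ++ₚ reverseₚ q₂)
      forward (inj₂ (inj₂ (q₁ , _)))  = inj₁ q₁
    ...   | inj₂ (refl , refl) = backward via
      where
      backward : PathVia F f x (tgt f) → PathVia F f x (src f)
      backward (inj₁ q)                = inj₂ (inj₂ (q , []))
      backward (inj₂ (inj₁ (q₁ , _)))  = inj₁ q₁
      backward (inj₂ (inj₂ (q₁ , q₂))) = inj₁ (q₁ ++ₚ reverseₚ q₂)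

    componentEdges : EdgeSet m → Fin n → EdgeSet m
    componentEdges F u g = F g ∧ connected F u (src g)

    -- Deleting an edge f of a forest splits the component of u into those of
    -- the two endpoints of f: hence a tree has one more vertex than edges.
    module CutEdge (F : EdgeSet m) (f : Fin m) (Ff : F f ≡ true) (forest : Forest F)
                   {u : Fin n} (u~a : Path F u (src f)) where
      F∖f : EdgeSet m
      F∖f = remove F f

      a b : Fin n
      a = src f
      b = tgt f

      a≁b : ¬ Path F∖f a b
      a≁b = forest f Ff

      vertices-split : ∀ v → connected F u v ≡ (connected F∖f a v ∨ connected F∖f b v)
      vertices-split v = true-⇔⇒≡ to from
        where
        to : connected F u v ≡ true → (connected F∖f a v ∨ connected F∖f b v) ≡ true
        to c with splitAt F f (reverseₚ u~a ++ₚ connected⇒Path c)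
        ... | inj₁ q                = ∨-introˡ _ (Path⇒connected q)
        ... | inj₂ (inj₁ (_ , q))   = ∨-introʳ (connected F∖f a v) (Path⇒connected q)
        ... | inj₂ (inj₂ (q , _))   = ⊥-elim (a≁b q)
        from : (connected F∖f a v ∨ connected F∖f b v) ≡ true → connected F u v ≡ true
        from c with ∨-elim {connected F∖f a v} c
        ... | inj₁ a~v = Path⇒connected (u~a ++ₚ Path-mono (remove-⊆ F f) (connected⇒Path a~v))
        ... | inj₂ b~v = Path⇒connected ((u~a ▷ edgeStep f Ff) ++ₚ Path-mono (remove-⊆ F f) (connected⇒Path b~v))

      vertices-disjoint : ∀ v → connected F∖f a v ≡ true → connected F∖f b v ≡ true → ⊥
      vertices-disjoint v a~v b~v = a≁b (connected⇒Path a~v ++ₚ reverseₚ (connected⇒Path b~v))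

      edges-split : ∀ g → componentEdges F u g ≡ ((componentEdges F∖f a g ∨ componentEdges F∖f b g) ∨ (g == f))
      edges-split g with g Fin.≟ f
      ... | yes refl = trans (∧-intro Ff (Path⇒connected u~a)) (sym (∨-introʳ _ refl))
      ... | no _ with F g
      ...   | false = refl
      ...   | true  = trans (vertices-split (src g)) (sym (∨-identityʳ _))

      edges-disjoint : ∀ g → componentEdges F∖f a g ≡ true → componentEdges F∖f b g ≡ true → ⊥
      edges-disjoint g ea eb = vertices-disjoint (src g) (proj₂ (∧-elim {F∖f g} ea)) (proj₂ (∧-elim {F∖f g} eb))

      edges-without-f : ∀ g → (componentEdges F∖f a g ∨ componentEdges F∖f b g) ≡ true → (g == f) ≡ true → ⊥
      edges-without-f g e g==f with ==⇒≡ g==f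
      ... | refl with ∨-elim {componentEdges F∖f a f} e
      ...   | inj₁ ea = not-¬ (proj₁ (∧-elim ea)) (remove-self F f)
      ...   | inj₂ eb = not-¬ (proj₁ (∧-elim eb)) (remove-self F f)

      count-vertices : count n (connected F u) ≡ count n (connected F∖f a) + count n (connected F∖f b)
      count-vertices = count-disjoint-∨ n vertices-split vertices-disjoint

      count-edges : count m (componentEdges F u) ≡
                    count m (componentEdges F∖f a) + count m (componentEdges F∖f b) + 1
      count-edges = begin
        count m (componentEdges F u)       ≡⟨ count-disjoint-∨ m edges-split edges-without-f ⟩
        count m Eab + count m (_== f)      ≡⟨ cong (count m Eab +_) (count-single m f (≡⇒== refl) (λ _ → ==⇒≡)) ⟩
        count m Eab + 1                    ≡⟨ cong (_+ 1) (count-disjoint-∨ m (λ _ → refl) edges-disjoint) ⟩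
        count m (componentEdges F∖f a) + count m (componentEdges F∖f b) + 1 ∎
        where
        open ≡-Reasoning
        Eab : EdgeSet m
        Eab g = componentEdges F∖f a g ∨ componentEdges F∖f b g

    component-size : ∀ {F} → Forest F → ∀ u →
      count n (connected F u) ≡ suc (count m (componentEdges F u))
    component-size {F} = go m (count≤ m F)
      where
      go : ∀ k {F} → count m F ≤ k → Forest F → ∀ u → count n (connected F u) ≡ suc (count m (componentEdges F u))
      go k {F} size forest u with anyFin m (componentEdges F u) in hasEdge
      ... | false = trans (count-single n u (Path⇒connected []) isolated)
                          (cong suc (sym (count-none m (¬anyFin⇒∀ m hasEdge))))
        where
        isolated : ∀ v → connected F u v ≡ true → v ≡ u
        isolated v c with lastEdge (connected⇒Path c)
        ... | inj₁ v≡u                = v≡u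
        ... | inj₂ (g , Fg , u~g , _) = ⊥-elim (not-¬ (∧-intro Fg (Path⇒connected u~g)) (¬anyFin⇒∀ m hasEdge g))
      ... | true with anyFin⇒∃ m hasEdge
      ...   | f , edge-f with ∧-elim {F f} edge-f
      ...     | Ff , u~a with k
      ...       | zero   = ⊥-elim (ℕₚ.<⇒≱ (count-pos m f Ff) size)
      ...       | suc k′ = begin
        count n (connected F u)                                 ≡⟨ count-vertices ⟩
        count n (connected F∖f a) + count n (connected F∖f b)   ≡⟨ cong₂ _+_ (IH a) (IH b) ⟩
        suc eₐ + suc e_b                                        ≡⟨ cong suc (ℕₚ.+-suc eₐ e_b) ⟩
        suc (suc (eₐ + e_b))                                    ≡⟨ cong suc (ℕₚ.+-comm 1 (eₐ + e_b)) ⟩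
        suc (eₐ + e_b + 1)                                      ≡⟨ cong suc count-edges ⟨
        suc (count m (componentEdges F u))                      ∎
        where
        open ≡-Reasoning
        open CutEdge F f Ff forest (connected⇒Path u~a)
        smaller : count m F∖f ≤ k′
        smaller = ℕₚ.≤-pred (ℕₚ.≤-trans (count-mono-< m (remove-⊆ F f) f Ff (remove-self F f)) size)
        IH : ∀ v → count n (connected F∖f v) ≡ suc (count m (componentEdges F∖f v))
        IH = go k′ smaller (Forest-antimono (remove-⊆ F f) forest)
        eₐ e_b : ℕ
        eₐ = count m (componentEdges F∖f a)
        e_b = count m (componentEdges F∖f b)

    broken-cong : ∀ {S S′} → S ≗ S′ → ∀ f → broken S f ≡ broken S′ f
    broken-cong S≗S′ f = cong₂ (λ x y → not x ∧ y) (S≗S′ f) (connected-cong (λ e → cong (_∧ (e <ᵇ f)) (S≗S′ e)) _ _)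

  module Components {n m : ℕ} (G : Graph n m) where
    open Graph G
    open GraphNotions G
    open Walks G

    vertexSet-component : ∀ F e → F e ≡ true → vertexSet (component F e) ≗ connected F (src e)
    vertexSet-component F e Fe v = true-⇔⇒≡ to from
      where
      to : vertexSet (component F e) v ≡ true → connected F (src e) v ≡ true
      to inV with anyFin⇒∃ m inV
      ... | g , Tg∧ends with ∧-elim Tg∧ends
      ...   | Tg , ends with ∧-elim {F g} Tg | ∨-elim {src g == v} ends
      ...     | Fg , g~e | inj₁ s = subst (λ w → connected F (src e) w ≡ true) (==⇒≡ s)
                                          (trans (connected-sym F (src e) (src g)) g~e)
      ...     | Fg , g~e | inj₂ t = subst (λ w → connected F (src e) w ≡ true) (==⇒≡ t)
                                          (Path⇒connected (reverseₚ (connected⇒Path g~e) ▷ edgeStep g Fg))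
      from : connected F (src e) v ≡ true → vertexSet (component F e) v ≡ true
      from c with lastEdge (connected⇒Path c)
      ... | inj₁ refl =
        ∃⇒anyFin m e (∧-intro (∧-intro Fe (Path⇒connected [])) (∨-introˡ (tgt e == src e) (≡⇒== {i = src e} refl)))
      ... | inj₂ (g , Fg , e~g , ends) =
        ∃⇒anyFin m g (∧-intro (∧-intro Fg (Path⇒connected (reverseₚ e~g))) (endpoint ends))
        where
        endpoint : src g ≡ v ⊎ tgt g ≡ v → (src g == v ∨ tgt g == v) ≡ true
        endpoint (inj₁ s) = ∨-introˡ _ (≡⇒== s)
        endpoint (inj₂ t) = ∨-introʳ (src g == v) (≡⇒== t)

    component-vertex-count : ∀ {F} → Forest F → ∀ e → F e ≡ true →
      count n (vertexSet (component F e)) ≡ suc (count m (component F e))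
    component-vertex-count {F} forest e Fe = begin
      count n (vertexSet (component F e))
        ≡⟨ count-cong n (vertexSet-component F e Fe) ⟩
      count n (connected F (src e))
        ≡⟨ component-size forest (src e) ⟩
      suc (count m (componentEdges F (src e)))
        ≡⟨ cong suc (count-cong m λ g → cong (F g ∧_) (connected-sym F (src e) (src g))) ⟩
      suc (count m (component F e)) ∎
      where open ≡-Reasoning

    reaching : EdgeSet m → Fin n → EdgeSet m
    reaching F v g = F g ∧ connected F (src g) v

    isRep-IsLeast : ∀ F v e → (isRep F e ∧ connected F (src e) v) ≡ IsLeast (reaching F v) e
    isRep-IsLeast F v e with connected F (src e) v in e~v
    ... | false = trans (∧-zeroʳ (isRep F e))
                        (sym (cong (_∧ allFin m (λ g → not (g <ᵇ e ∧ reaching F v g))) (∧-zeroʳ (F e))))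
    ... | true  = trans (∧-identityʳ (isRep F e))
                        (cong₂ _∧_ (sym (∧-identityʳ (F e)))
                                   (allFin-cong m λ g → cong (λ c → not (g <ᵇ e ∧ (F g ∧ c))) (same-component g)))
      where
      same-component : ∀ g → connected F (src g) (src e) ≡ connected F (src g) v
      same-component g = true-⇔⇒≡ (λ c → Path⇒connected (connected⇒Path c ++ₚ connected⇒Path e~v))
                                  (λ c → Path⇒connected (connected⇒Path c ++ₚ reverseₚ (connected⇒Path e~v)))

    reps-disjoint : ∀ F {e e′} v → isRep F e ≡ true → isRep F e′ ≡ true →
      connected F (src e) v ≡ true → connected F (src e′) v ≡ true → e ≡ e′
    reps-disjoint F {e} {e′} v rep rep′ e~v e′~v =
      IsLeast-unique (reaching F v) (trans (sym (isRep-IsLeast F v e)) (∧-intro rep e~v))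
                                    (trans (sym (isRep-IsLeast F v e′)) (∧-intro rep′ e′~v))

    count-reps-reaching : ∀ F v (b : Bool) → (b ≡ true → ∃[ g ] reaching F v g ≡ true) →
      count m (λ e → b ∧ (isRep F e ∧ connected F (src e) v)) ≡ [ b ]ℕ
    count-reps-reaching F v false _       = count-none m (λ _ → refl)
    count-reps-reaching F v true  reached = begin
      count m (λ e → isRep F e ∧ connected F (src e) v)   ≡⟨ count-cong m (isRep-IsLeast F v) ⟩
      count m (IsLeast (reaching F v))                    ≡⟨ count-IsLeast m (reaching F v) ⟩
      [ anyFin m (reaching F v) ]ℕ                         ≡⟨ cong [_]ℕ (∃⇒anyFin m _ (proj₂ (reached refl))) ⟩
      1                                                   ∎
      where open ≡-Reasoning

    count-reps-component : ∀ F f → count m (λ e → isRep F e ∧ component F e f) ≡ [ F f ]ℕ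
    count-reps-component F f = trans (count-cong m regroup)
      (count-reps-reaching F (src f) (F f) λ Ff → f , ∧-intro Ff (Path⇒connected []))
      where
      swap : ∀ a b {c d} → c ≡ d → (a ∧ (b ∧ c)) ≡ (b ∧ (a ∧ d))
      swap true  true  refl = refl
      swap true  false refl = refl
      swap false true  refl = refl
      swap false false refl = refl
      regroup : ∀ e → (isRep F e ∧ component F e f) ≡ (F f ∧ (isRep F e ∧ connected F (src e) (src f)))
      regroup e = swap (isRep F e) (F f) (connected-sym F (src f) (src e))

    below-⊆ : ∀ T f → below T f ⊆ T
    below-⊆ T f g b = proj₁ (∧-elim b)

    Path-below-component : ∀ F f e {x y} → Path F (src e) x → Path (below F f) x y →
      Path (below (component F e) f) x y
    Path-below-component F f e e~x []                            = []
    Path-below-component F f e e~x (_▷_ {v} p (g , Fg<f , ends)) =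
      Path-below-component F f e e~x p ▷ (g , ∧-intro (∧-intro Fg (Path⇒connected (reverseₚ (e~g ends)))) g<f , ends)
      where
      Fg : F g ≡ true
      Fg = proj₁ (∧-elim Fg<f)
      g<f : (g <ᵇ f) ≡ true
      g<f = proj₂ (∧-elim {F g} Fg<f)
      e~v : Path F (src e) v
      e~v = e~x ++ₚ Path-mono (below-⊆ F f) p
      e~g : ∀ {w} → Joins g v w → Path F (src e) (src g)
      e~g (inj₁ (refl , _))  = e~v
      e~g (inj₂ (refl , tg)) = e~v ▷ (g , Fg , inj₂ (refl , tg))

    brokenInduced-component : ∀ F e f → F e ≡ true →
      brokenInduced (component F e) f ≡ (broken F f ∧ connected F (src e) (src f))
    brokenInduced-component F e f Fe = true-⇔⇒≡ to from
      where
      T : EdgeSet m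
      T = component F e
      inT : ∀ v → vertexSet T v ≡ connected F (src e) v
      inT = vertexSet-component F e Fe
      to : brokenInduced T f ≡ true → (broken F f ∧ connected F (src e) (src f)) ≡ true
      to bi with ∧-elim {vertexSet T (src f)} bi
      ... | srcIn , rest with ∧-elim {vertexSet T (tgt f)} rest
      ...   | _ , brokenT with ∧-elim {not (T f)} brokenT
      ...     | notTf , cycle = ∧-intro (∧-intro (not-intro notFf) (Path⇒connected below-path)) e~f
        where
        e~f : connected F (src e) (src f) ≡ true
        e~f = trans (sym (inT (src f))) srcIn
        notFf : F f ≡ false
        notFf = ¬-not λ Ff → not-¬ (∧-intro {F f} Ff (trans (connected-sym F (src f) (src e)) e~f)) (not-elim notTf)
        below-path : Path (below F f) (src f) (tgt f)
        below-path = Path-mono (λ g b → let Tg , g<f = ∧-elim {T g} b in ∧-intro (proj₁ (∧-elim Tg)) g<f)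
                               (connected⇒Path cycle)
      from : (broken F f ∧ connected F (src e) (src f)) ≡ true → brokenInduced T f ≡ true
      from bf∧e~f with ∧-elim bf∧e~f
      ... | bf , e~f with ∧-elim bf
      ...   | notFf , cycle =
        ∧-intro (trans (inT (src f)) e~f)
          (∧-intro (trans (inT (tgt f)) (Path⇒connected (e→f ++ₚ Path-mono (below-⊆ F f) f→f)))
            (∧-intro (not-intro (¬-not λ Tf → not-¬ (proj₁ (∧-elim Tf)) (not-elim notFf)))
              (Path⇒connected (Path-below-component F f e e→f f→f))))
        where
        e→f : Path F (src e) (src f)
        e→f = connected⇒Path e~f
        f→f : Path (below F f) (src f) (tgt f)
        f→f = connected⇒Path cycle

    count-reps-broken : ∀ F f → count m (λ e → isRep F e ∧ brokenInduced (component F e) f) ≡ [ broken F f ]ℕ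
    count-reps-broken F f = trans (count-cong m regroup) (count-reps-reaching F (src f) (broken F f) reached)
      where
      regroup : ∀ e → (isRep F e ∧ brokenInduced (component F e) f) ≡
                      (broken F f ∧ (isRep F e ∧ connected F (src e) (src f)))
      regroup e with isRep F e in rep
      ... | false = sym (∧-zeroʳ (broken F f))
      ... | true  = brokenInduced-component F e f (proj₁ (∧-elim rep))
      reached : broken F f ≡ true → ∃[ g ] reaching F (src f) g ≡ true
      reached bf with lastEdge (connected⇒Path (proj₂ (∧-elim {not (F f)} bf)))
      ... | inj₁ tgt≡src                = ⊥-elim (loopless f (sym tgt≡src))
      ... | inj₂ (g , Fg<f , f→g , _) =
        g , ∧-intro (below-⊆ F f g Fg<f) (Path⇒connected (reverseₚ (Path-mono (below-⊆ F f) f→g)))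

  deleteLast : ∀ {n m} → Graph n (suc m) → Graph n m
  deleteLast G = record
    { src      = λ i → src (inject₁ i)
    ; tgt      = λ i → tgt (inject₁ i)
    ; loopless = λ i → loopless (inject₁ i)
    ; simple   = λ i j ends → Finₚ.inject₁-injective (simple (inject₁ i) (inject₁ j) ends)
    }
    where open Graph G

  module LastEdge {n m : ℕ} (G : Graph n (suc m)) where
    open Graph G
    open GraphNotions G
    open Walks G
    module G⁻ where
      open Graph (deleteLast G) public
      open GraphNotions (deleteLast G) public
      open Walks (deleteLast G) public

    eₘ : Fin (suc m)
    eₘ = fromℕ m

    a b : Fin n
    a = src eₘ
    b = tgt eₘ

    Matches : EdgeSet (suc m) → EdgeSet m → Set
    Matches S S⁻ = (∀ i → S (inject₁ i) ≡ S⁻ i) × S eₘ ≡ false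

    Path-restrict : ∀ {S S⁻ u v} → Matches S S⁻ → Path S u v → G⁻.Path S⁻ u v
    Path-restrict match []                   = G⁻.[]
    Path-restrict (old , new) (p ▷ (e , Se , ends)) with inject₁-or-last e
    ... | inj₁ (i , refl) = Path-restrict (old , new) p G⁻.▷ (i , trans (sym (old i)) Se , ends)
    ... | inj₂ refl       = ⊥-elim (not-¬ Se new)

    Path-extend : ∀ {S S⁻ u v} → Matches S S⁻ → G⁻.Path S⁻ u v → Path S u v
    Path-extend match G⁻.[]                       = []
    Path-extend (old , new) (p G⁻.▷ (i , Si , ends)) = Path-extend (old , new) p ▷ (inject₁ i , trans (old i) Si , ends)

    connected-Matches : ∀ {S S⁻} → Matches S S⁻ → ∀ u v → connected S u v ≡ G⁻.connected S⁻ u v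
    connected-Matches match u v = true-⇔⇒≡ (λ c → G⁻.Path⇒connected (Path-restrict match (connected⇒Path c)))
                                           (λ c → Path⇒connected (Path-extend match (G⁻.connected⇒Path c)))

    module _ (ρ : EdgeSet m) where
      ρ₀ ρ₁ : EdgeSet (suc m)
      ρ₀ = ρ ∷ʳ false
      ρ₁ = ρ ∷ʳ true

      remove-Matches : ∀ {F} i → (∀ j → F (inject₁ j) ≡ ρ j) → F eₘ ≡ false →
        Matches (remove F (inject₁ i)) (G⁻.remove ρ i)
      remove-Matches {F} i old new =
        (λ j → cong₂ (λ x y → x ∧ not y) (old j) (inject₁-== j i)) , cong (_∧ not (eₘ == inject₁ i)) new

      remove-last-Matches : Matches (remove ρ₁ eₘ) ρ
      remove-last-Matches =
        (λ j → trans (cong₂ (λ x y → x ∧ not y) (∷ʳ-inject₁ ρ true j) (inject₁-==-last j)) (∧-identityʳ (ρ j))) ,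
        trans (cong (λ y → ρ₁ eₘ ∧ not y) (≡⇒== {i = eₘ} refl)) (∧-zeroʳ (ρ₁ eₘ))

      isForest-ρ₀ : isForest ρ₀ ≡ G⁻.isForest ρ
      isForest-ρ₀ = true-⇔⇒≡
        (λ isF → G⁻.Forest⇒isForest λ i ρi p →
           isForest⇒Forest isF (inject₁ i) (trans (∷ʳ-inject₁ ρ false i) ρi) (Path-extend (remove₀ i) p))
        (λ isF → Forest⇒isForest (forest₀ (G⁻.isForest⇒Forest isF)))
        where
        remove₀ : ∀ i → Matches (remove ρ₀ (inject₁ i)) (G⁻.remove ρ i)
        remove₀ i = remove-Matches {ρ₀} i (∷ʳ-inject₁ ρ false) (∷ʳ-last ρ false)
        forest₀ : G⁻.Forest ρ → Forest ρ₀
        forest₀ forest e ρ₀e p with inject₁-or-last e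
        ... | inj₁ (i , refl) = forest i (trans (sym (∷ʳ-inject₁ ρ false i)) ρ₀e) (Path-restrict (remove₀ i) p)
        ... | inj₂ refl       = not-¬ ρ₀e (∷ʳ-last ρ false)

      -- A cycle through an old edge i either avoids eₘ, and then lies in ρ, or
      -- passes through eₘ, and then its other edges join a to b in ρ.
      Forest-ρ₁ : G⁻.Forest ρ → ¬ G⁻.Path ρ a b → Forest ρ₁
      Forest-ρ₁ forest a≁b e ρ₁e p with inject₁-or-last e
      ... | inj₂ refl       = a≁b (Path-restrict remove-last-Matches p)
      ... | inj₁ (i , refl) = noCycle (splitAt S eₘ p)
        where
        S : EdgeSet (suc m)
        S = remove ρ₁ (inject₁ i)
        ρi : ρ i ≡ true
        ρi = trans (sym (∷ʳ-inject₁ ρ true i)) ρ₁e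
        S∖eₘ-Matches : Matches (remove S eₘ) (G⁻.remove ρ i)
        S∖eₘ-Matches =
          (λ j → trans (cong₂ (λ x y → (x ∧ not y) ∧ not (inject₁ j == eₘ)) (∷ʳ-inject₁ ρ true j) (inject₁-== j i))
                       (trans (cong (λ y → (ρ j ∧ not (j == i)) ∧ not y) (inject₁-==-last j)) (∧-identityʳ _))) ,
          trans (cong (λ y → S eₘ ∧ not y) (≡⇒== {i = eₘ} refl)) (∧-zeroʳ (S eₘ))
        lift : ∀ {x y} → Path (remove S eₘ) x y → G⁻.Path ρ x y
        lift q = G⁻.Path-mono (G⁻.remove-⊆ ρ i) (Path-restrict S∖eₘ-Matches q)
        noCycle : PathVia S eₘ (src (inject₁ i)) (tgt (inject₁ i)) → ⊥
        noCycle (inj₁ q)                = forest i ρi (Path-restrict S∖eₘ-Matches q)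
        noCycle (inj₂ (inj₁ (q₁ , q₂))) =
          a≁b ((G⁻.reverseₚ (lift q₁) G⁻.▷ G⁻.edgeStep i ρi) G⁻.++ₚ G⁻.reverseₚ (lift q₂))
        noCycle (inj₂ (inj₂ (q₁ , q₂))) =
          a≁b ((lift q₂ G⁻.▷ G⁻.Step-sym (G⁻.edgeStep i ρi)) G⁻.++ₚ lift q₁)

      isForest-ρ₁ : isForest ρ₁ ≡ (G⁻.isForest ρ ∧ not (G⁻.connected ρ a b))
      isForest-ρ₁ = true-⇔⇒≡ to from
        where
        to : isForest ρ₁ ≡ true → (G⁻.isForest ρ ∧ not (G⁻.connected ρ a b)) ≡ true
        to isF = ∧-intro (trans (sym isForest-ρ₀) (Forest⇒isForest (Forest-antimono ρ₀⊆ρ₁ forest₁)))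
                         (not-intro (¬-not λ a~b → forest₁ eₘ (∷ʳ-last ρ true)
                                                      (Path-extend remove-last-Matches (G⁻.connected⇒Path a~b))))
          where
          forest₁ : Forest ρ₁
          forest₁ = isForest⇒Forest isF
          ρ₀⊆ρ₁ : ρ₀ ⊆ ρ₁
          ρ₀⊆ρ₁ e ρ₀e with inject₁-or-last e
          ... | inj₁ (i , refl) = trans (∷ʳ-inject₁ ρ true i) (trans (sym (∷ʳ-inject₁ ρ false i)) ρ₀e)
          ... | inj₂ refl       = ⊥-elim (not-¬ ρ₀e (∷ʳ-last ρ false))
        from : (G⁻.isForest ρ ∧ not (G⁻.connected ρ a b)) ≡ true → isForest ρ₁ ≡ true
        from h = let isF , a≁b = ∧-elim {G⁻.isForest ρ} h in
          Forest⇒isForest (Forest-ρ₁ (G⁻.isForest⇒Forest isF) (λ p → not-¬ (G⁻.Path⇒connected p) (not-elim a≁b)))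

      -- eₘ is the largest edge, so it never lies below an old edge.
      broken-inject₁ : ∀ F → (∀ j → F (inject₁ j) ≡ ρ j) → ∀ i → broken F (inject₁ i) ≡ G⁻.broken ρ i
      broken-inject₁ F old i = cong₂ (λ x y → not x ∧ y) (old i) (connected-Matches below-Matches _ _)
        where
        below-Matches : Matches (below F (inject₁ i)) (G⁻.below ρ i)
        below-Matches = (λ j → cong₂ _∧_ (old j) (inject₁-<ᵇ j i)) ,
                        trans (cong (F eₘ ∧_) (≮⇒<ᵇfalse (ℕₚ.<⇒≯ (inject₁<last i)))) (∧-zeroʳ (F eₘ))

      broken-ρ₀-eₘ : broken ρ₀ eₘ ≡ G⁻.connected ρ a b
      broken-ρ₀-eₘ = trans (cong (λ x → not x ∧ connected (below ρ₀ eₘ) a b) (∷ʳ-last ρ false))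
                          (connected-Matches below-eₘ-Matches a b)
        where
        below-eₘ-Matches : Matches (below ρ₀ eₘ) ρ
        below-eₘ-Matches = (λ j → trans (cong₂ _∧_ (∷ʳ-inject₁ ρ false j) (<⇒<ᵇ (inject₁<last j))) (∧-identityʳ (ρ j))) ,
                          cong (_∧ (eₘ <ᵇ eₘ)) (∷ʳ-last ρ false)

      broken-ρ₁-eₘ : broken ρ₁ eₘ ≡ false
      broken-ρ₁-eₘ = cong (λ x → not x ∧ connected (below ρ₁ eₘ) a b) (∷ʳ-last ρ true)

open Combinatorics

module FiniteSums {c ℓ : Level} (R : CommutativeRing c ℓ) where
  open CommutativeRing R hiding (zero)
  open RingNotions R
  open import Relation.Binary.Reasoning.Setoid setoid
  private
    module Σ = MonoidSum +-commutativeMonoid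
    module Π = MonoidSum *-commutativeMonoid
    module Σ* = SemiringSum semiring

  sumFin≡sum : ∀ k (f : Fin k → Carrier) → sumFin k f ≡ Σ.sum f
  sumFin≡sum zero    f = ≡.refl
  sumFin≡sum (suc k) f = ≡.cong (f zero +_) (sumFin≡sum k (λ i → f (suc i)))

  prodFin≡∏ : ∀ k (f : Fin k → Carrier) → prodFin k f ≡ Π.sum f
  prodFin≡∏ zero    f = ≡.refl
  prodFin≡∏ (suc k) f = ≡.cong (f zero *_) (prodFin≡∏ k (λ i → f (suc i)))

  sumFin-cong : ∀ k {f g : Fin k → Carrier} → (∀ i → f i ≈ g i) → sumFin k f ≈ sumFin k g
  sumFin-cong zero    _   = refl
  sumFin-cong (suc k) f≈g = +-cong (f≈g zero) (sumFin-cong k (λ i → f≈g (suc i)))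

  prodFin-cong : ∀ k {f g : Fin k → Carrier} → (∀ i → f i ≈ g i) → prodFin k f ≈ prodFin k g
  prodFin-cong zero    _   = refl
  prodFin-cong (suc k) f≈g = *-cong (f≈g zero) (prodFin-cong k (λ i → f≈g (suc i)))

  sumFin-+ : ∀ k (f g : Fin k → Carrier) → sumFin k (λ i → f i + g i) ≈ sumFin k f + sumFin k g
  sumFin-+ k f g = ≡.subst₂ _≈_ (≡.sym (sumFin≡sum k _)) (≡.sym (≡.cong₂ _+_ (sumFin≡sum k f) (sumFin≡sum k g)))
                            (Σ.∑-distrib-+ f g)

  *-distribˡ-sumFin : ∀ k a (f : Fin k → Carrier) → a * sumFin k f ≈ sumFin k (λ i → a * f i)
  *-distribˡ-sumFin k a f = ≡.subst₂ _≈_ (≡.cong (a *_) (≡.sym (sumFin≡sum k f))) (≡.sym (sumFin≡sum k _))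
                                     (Σ*.*-distribˡ-sum a f)

  sumFin-const : ∀ k a → sumFin k (λ _ → a) ≈ fromℕ k * a
  sumFin-const zero    a = sym (zeroˡ a)
  sumFin-const (suc k) a = trans (+-cong (sym (*-identityˡ a)) (sumFin-const k a)) (sym (distribʳ a 1# (fromℕ k)))

  prodFin-* : ∀ k (f g : Fin k → Carrier) → prodFin k (λ i → f i * g i) ≈ prodFin k f * prodFin k g
  prodFin-* k f g = ≡.subst₂ _≈_ (≡.sym (prodFin≡∏ k _)) (≡.sym (≡.cong₂ _*_ (prodFin≡∏ k f) (prodFin≡∏ k g)))
                             (Π.∑-distrib-+ f g)

  prodFin-1# : ∀ k → prodFin k (λ _ → 1#) ≈ 1#
  prodFin-1# k = ≡.subst (_≈ 1#) (≡.sym (prodFin≡∏ k _)) (Π.sum-replicate-zero k)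

  prodFin-comm : ∀ k l (h : Fin k → Fin l → Carrier) →
    prodFin k (λ i → prodFin l (h i)) ≈ prodFin l (λ j → prodFin k (λ i → h i j))
  prodFin-comm k l h = ≡.subst₂ _≈_ (≡.sym (≡.trans (prodFin≡∏ k _) (Π.sum-cong-≗ (λ i → prodFin≡∏ l (h i)))))
                                    (≡.sym (≡.trans (prodFin≡∏ l _) (Π.sum-cong-≗ (λ j → prodFin≡∏ k (λ i → h i j)))))
                                    (Π.∑-comm h)

  prodFin-init-last : ∀ k (f : Fin (suc k) → Carrier) →
    prodFin (suc k) f ≈ prodFin k (λ i → f (inject₁ i)) * f (Fin.fromℕ k)
  prodFin-init-last k f = ≡.subst₂ _≈_ (≡.sym (prodFin≡∏ (suc k) f)) (≡.cong (_* f (Fin.fromℕ k)) (≡.sym (prodFin≡∏ k _)))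
                                     (Π.sum-init-last f)

  prodFin-if≈^count : ∀ k (p : Fin k → Bool) a → prodFin k (λ i → if p i then a else 1#) ≈ a ^ᴿ count k p
  prodFin-if≈^count zero    p a = refl
  prodFin-if≈^count (suc k) p a with p zero
  ... | true  = *-congˡ (prodFin-if≈^count k _ a)
  ... | false = trans (*-identityˡ _) (prodFin-if≈^count k _ a)

  sumMaps-cong : ∀ n q {f g : (Fin n → Fin q) → Carrier} → (∀ φ → f φ ≈ g φ) → sumMaps n q f ≈ sumMaps n q g
  sumMaps-cong zero    q f≈g = f≈g _
  sumMaps-cong (suc n) q f≈g = sumFin-cong q (λ a → sumMaps-cong n q (λ φ → f≈g _))

  sumMaps-+ : ∀ n q (f g : (Fin n → Fin q) → Carrier) →
    sumMaps n q (λ φ → f φ + g φ) ≈ sumMaps n q f + sumMaps n q g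
  sumMaps-+ zero    q f g = refl
  sumMaps-+ (suc n) q f g = trans (sumFin-cong q (λ a → sumMaps-+ n q _ _)) (sumFin-+ q _ _)

  *-distribˡ-sumMaps : ∀ n q a (f : (Fin n → Fin q) → Carrier) → a * sumMaps n q f ≈ sumMaps n q (λ φ → a * f φ)
  *-distribˡ-sumMaps zero    q a f = refl
  *-distribˡ-sumMaps (suc n) q a f = trans (*-distribˡ-sumFin q a _) (sumFin-cong q (λ b → *-distribˡ-sumMaps n q a _))

  Respects≗ : ∀ k → ((Fin k → Bool) → Carrier) → Set _
  Respects≗ k f = ∀ {S S′} → S ≗ S′ → f S ≈ f S′

  module _ {n m : ℕ} (G : Graph n m) where
    sumSubsets-cong : ∀ k {f g : (Fin k → Bool) → Carrier} → (∀ S → f S ≈ g S) → sumSubsets G k f ≈ sumSubsets G k g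
    sumSubsets-cong zero    f≈g = f≈g _
    sumSubsets-cong (suc k) f≈g = +-cong (sumSubsets-cong k (λ S → f≈g _)) (sumSubsets-cong k (λ S → f≈g _))

    *-distribˡ-sumSubsets : ∀ k a (f : (Fin k → Bool) → Carrier) →
      a * sumSubsets G k f ≈ sumSubsets G k (λ S → a * f S)
    *-distribˡ-sumSubsets zero    a f = refl
    *-distribˡ-sumSubsets (suc k) a f =
      trans (distribˡ a _ _) (+-cong (*-distribˡ-sumSubsets k a _) (*-distribˡ-sumSubsets k a _))

    sumMaps-sumSubsets : ∀ k n′ q (h : (Fin n′ → Fin q) → (Fin k → Bool) → Carrier) →
      sumMaps n′ q (λ φ → sumSubsets G k (h φ)) ≈ sumSubsets G k (λ S → sumMaps n′ q (λ φ → h φ S))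
    sumMaps-sumSubsets zero    n′ q h = refl
    sumMaps-sumSubsets (suc k) n′ q h =
      trans (sumMaps-+ n′ q _ _) (+-cong (sumMaps-sumSubsets k n′ q _) (sumMaps-sumSubsets k n′ q _))

    sumSubsets-∷ʳ : ∀ k (f : (Fin (suc k) → Bool) → Carrier) → Respects≗ (suc k) f →
      sumSubsets G (suc k) f ≈ sumSubsets G k (λ ρ → f (ρ ∷ʳ true) + f (ρ ∷ʳ false))
    sumSubsets-∷ʳ zero    f resp = +-cong (resp λ { zero → ≡.refl }) (resp λ { zero → ≡.refl })
    sumSubsets-∷ʳ (suc k) f resp = +-cong (peel true) (peel false)
      where
      cons-∷ʳ : ∀ b (ρ : Fin k → Bool) c → cons {k = suc k} b (ρ ∷ʳ c) ≗ (cons b ρ ∷ʳ c)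
      cons-∷ʳ b ρ c zero    = ≡.refl
      cons-∷ʳ b ρ c (suc e) = ≡.refl
      peel : ∀ b → sumSubsets G (suc k) (λ S → f (cons b S)) ≈
                   sumSubsets G k (λ ρ → f (cons b ρ ∷ʳ true) + f (cons b ρ ∷ʳ false))
      peel b = trans (sumSubsets-∷ʳ k _ (λ S≗S′ → resp (cons-cong b S≗S′)))
                     (sumSubsets-cong k (λ ρ → +-cong (resp (cons-∷ʳ b ρ true)) (resp (cons-∷ʳ b ρ false))))

  -- sumSubsets takes the graph as an unused parameter.
  sumSubsets-graph-irrelevant : ∀ {n m n′ m′} (G : Graph n m) (G′ : Graph n′ m′) k f →
    sumSubsets G k f ≡ sumSubsets G′ k f
  sumSubsets-graph-irrelevant G G′ zero    f = ≡.refl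
  sumSubsets-graph-irrelevant G G′ (suc k) f =
    ≡.cong₂ _+_ (sumSubsets-graph-irrelevant G G′ k _) (sumSubsets-graph-irrelevant G G′ k _)

  ^[]ℕ : ∀ a b → a ^ᴿ [ b ]ℕ ≈ (if b then a else 1#)
  ^[]ℕ a true  = *-identityʳ a
  ^[]ℕ a false = refl

  ^count*prodFin : ∀ k a (S : Fin k → Bool) (h : Fin k → Carrier) →
    a ^ᴿ count k S * prodFin k (λ f → if S f then h f else 1#) ≈ prodFin k (λ f → if S f then a * h f else 1#)
  ^count*prodFin zero    a S h = *-identityʳ 1#
  ^count*prodFin (suc k) a S h with S zero
  ... | true  = trans (interchange _ _ _ _) (*-congˡ (^count*prodFin k a _ _))
    where open CommSemigroupProps *-commutativeSemigroup using (interchange)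
  ... | false = trans (x∙yz≈y∙xz _ _ _) (*-congˡ (^count*prodFin k a _ _))
    where open CommSemigroupProps *-commutativeSemigroup using (x∙yz≈y∙xz)

  -- The hypothesis says that the parts P i with r i partition Q.
  prodFin-partition : ∀ l k (r : Fin l → Bool) (P : Fin l → Fin k → Bool) (Q : Fin k → Bool) (h : Fin k → Carrier) →
    (∀ f → count l (λ i → r i ∧ P i f) ≡ [ Q f ]ℕ) →
    prodFin l (λ i → if r i then prodFin k (λ f → if P i f then h f else 1#) else 1#) ≈
    prodFin k (λ f → if Q f then h f else 1#)
  prodFin-partition l k r P Q h multiplicity = begin
    prodFin l (λ i → if r i then prodFin k (λ f → if P i f then h f else 1#) else 1#)
      ≈⟨ prodFin-cong l (λ i → guard (r i) i) ⟩
    prodFin l (λ i → prodFin k (λ f → if r i ∧ P i f then h f else 1#))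
      ≈⟨ prodFin-comm l k _ ⟩
    prodFin k (λ f → prodFin l (λ i → if r i ∧ P i f then h f else 1#))
      ≈⟨ prodFin-cong k (λ f → prodFin-if≈^count l _ (h f)) ⟩
    prodFin k (λ f → h f ^ᴿ count l (λ i → r i ∧ P i f))
      ≈⟨ prodFin-cong k (λ f → trans (reflexive (≡.cong (h f ^ᴿ_) (multiplicity f))) (^[]ℕ (h f) (Q f))) ⟩
    prodFin k (λ f → if Q f then h f else 1#) ∎
    where
    guard : ∀ b i → (if b then prodFin k (λ f → if P i f then h f else 1#) else 1#) ≈
                    prodFin k (λ f → if b ∧ P i f then h f else 1#)
    guard true  i = refl
    guard false i = sym (prodFin-1# k)

module Expansion {c ℓ : Level} (R : CommutativeRing c ℓ) where
  open CommutativeRing R hiding (zero)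
  open RingNotions R
  open FiniteSums R
  open import Relation.Binary.Reasoning.Setoid setoid
  open CommSemigroupProps *-commutativeSemigroup using (xy∙z≈y∙xz)

  forestTerm : ∀ {n m} (G : Graph n m) → (Fin m → Carrier) → EdgeSet m → Carrier
  forestTerm G y F =
    if isForest F then prodOver G F y * prodOver G (broken F) (λ e → 1# + y e) else 0#
    where open GraphNotions G

  if-cong : ∀ {b b′ x x′ y y′} → b ≡ b′ → x ≈ x′ → y ≈ y′ → (if b then x else y) ≈ (if b′ then x′ else y′)
  if-cong {true}  ≡.refl x≈x′ _   = x≈x′
  if-cong {false} ≡.refl _   y≈y′ = y≈y′

  prodOver-cong : ∀ {n m} (G : Graph n m) {S S′} h → S ≗ S′ → prodOver G S h ≈ prodOver G S′ h
  prodOver-cong {m = m} G h S≗S′ = prodFin-cong m (λ e → if-cong (S≗S′ e) refl refl)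

  forestTerm-respects : ∀ {n m} (G : Graph n m) y → Respects≗ m (forestTerm G y)
  forestTerm-respects G y S≗S′ =
    if-cong (isForest-cong S≗S′) (*-cong (prodOver-cong G y S≗S′) (prodOver-cong G _ (broken-cong S≗S′))) refl
    where open Walks G

  prodOver-init-last : ∀ {n m} (G : Graph n (suc m)) S S⁻ h → (∀ j → S (inject₁ j) ≡ S⁻ j) →
    prodOver G S h ≈
    prodOver (deleteLast G) S⁻ (λ i → h (inject₁ i)) * (if S (Fin.fromℕ m) then h (Fin.fromℕ m) else 1#)
  prodOver-init-last {m = m} G S S⁻ h S≗S⁻ =
    trans (prodFin-init-last m (λ e → if S e then h e else 1#))
          (*-congʳ (prodFin-cong m (λ j → if-cong (S≗S⁻ j) refl refl)))

  -- If the last edge closes a cycle only the forest without it survives, and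
  -- the edge is broken for it; otherwise both forests survive.
  last-edge-terms : ∀ forest closes P B yₘ →
    (if forest ∧ not closes then (P * yₘ) * (B * 1#) else 0#) +
    (if forest then (P * 1#) * (B * (if closes then 1# + yₘ else 1#)) else 0#)
    ≈ (1# + yₘ) * (if forest then P * B else 0#)
  last-edge-terms false closes P B yₘ = trans (+-identityˡ 0#) (sym (zeroʳ _))
  last-edge-terms true  true   P B yₘ = begin
    0# + (P * 1#) * (B * (1# + yₘ))   ≈⟨ +-identityˡ _ ⟩
    (P * 1#) * (B * (1# + yₘ))        ≈⟨ *-congʳ (*-identityʳ P) ⟩
    P * (B * (1# + yₘ))               ≈⟨ *-assoc _ _ _ ⟨
    (P * B) * (1# + yₘ)               ≈⟨ *-comm _ _ ⟩
    (1# + yₘ) * (P * B)               ∎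
  last-edge-terms true  false  P B yₘ = begin
    (P * yₘ) * (B * 1#) + (P * 1#) * (B * 1#)
      ≈⟨ +-cong (*-congˡ (*-identityʳ B)) (*-cong (*-identityʳ P) (*-identityʳ B)) ⟩
    (P * yₘ) * B + P * B
      ≈⟨ +-congʳ (xy∙z≈y∙xz P yₘ B) ⟩
    yₘ * (P * B) + P * B
      ≈⟨ +-congˡ (*-identityˡ _) ⟨
    yₘ * (P * B) + 1# * (P * B)
      ≈⟨ distribʳ _ _ _ ⟨
    (yₘ + 1#) * (P * B)
      ≈⟨ *-congʳ (+-comm _ _) ⟩
    (1# + yₘ) * (P * B) ∎

  forestTerm-∷ʳ : ∀ {n m} (G : Graph n (suc m)) (y : Fin (suc m) → Carrier) ρ →
    forestTerm G y (ρ ∷ʳ true) + forestTerm G y (ρ ∷ʳ false) ≈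
    (1# + y (Fin.fromℕ m)) * forestTerm (deleteLast G) (λ i → y (inject₁ i)) ρ
  forestTerm-∷ʳ {n} {m} G y ρ =
    trans (+-cong with-eₘ without-eₘ) (last-edge-terms (G⁻.isForest ρ) (G⁻.connected ρ a b) P B (y eₘ))
    where
    open LastEdge G
    open GraphNotions G
    G⁻ : Graph n m
    G⁻ = deleteLast G
    P B : Carrier
    P = prodOver G⁻ ρ (λ i → y (inject₁ i))
    B = prodOver G⁻ (G⁻.broken ρ) (λ i → 1# + y (inject₁ i))
    optional : Bool → Carrier → Carrier
    optional c z = if c then z else 1#
    products : ∀ c → prodOver G (ρ ∷ʳ c) y * prodOver G (broken (ρ ∷ʳ c)) (λ e → 1# + y e) ≈
                     (P * optional c (y eₘ)) * (B * optional (broken (ρ ∷ʳ c) eₘ) (1# + y eₘ))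
    products c =
      *-cong (trans (prodOver-init-last G (ρ ∷ʳ c) ρ y (∷ʳ-inject₁ ρ c))
                    (*-congˡ (reflexive (≡.cong (λ d → optional d (y eₘ)) (∷ʳ-last ρ c)))))
             (prodOver-init-last G (broken (ρ ∷ʳ c)) (G⁻.broken ρ) (λ e → 1# + y e)
                                 (broken-inject₁ ρ (ρ ∷ʳ c) (∷ʳ-inject₁ ρ c)))
    eₘ-broken : ∀ c {d} → broken (ρ ∷ʳ c) eₘ ≡ d →
      (P * optional c (y eₘ)) * (B * optional (broken (ρ ∷ʳ c) eₘ) (1# + y eₘ)) ≈
      (P * optional c (y eₘ)) * (B * optional d (1# + y eₘ))
    eₘ-broken c ≡.refl = refl
    with-eₘ : forestTerm G y (ρ ∷ʳ true) ≈
              (if G⁻.isForest ρ ∧ not (G⁻.connected ρ a b) then (P * y eₘ) * (B * 1#) else 0#)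
    with-eₘ = if-cong (isForest-ρ₁ ρ) (trans (products true) (eₘ-broken true (broken-ρ₁-eₘ ρ))) refl
    without-eₘ : forestTerm G y (ρ ∷ʳ false) ≈
                 (if G⁻.isForest ρ then (P * 1#) * (B * optional (G⁻.connected ρ a b) (1# + y eₘ)) else 0#)
    without-eₘ = if-cong (isForest-ρ₀ ρ) (trans (products false) (eₘ-broken false (broken-ρ₀-eₘ ρ))) refl

  broken-circuit-expansion : ∀ {n} m (G : Graph n m) (y : Fin m → Carrier) →
    sumSubsets G m (forestTerm G y) ≈ prodFin m (λ e → 1# + y e)
  broken-circuit-expansion zero    G y = *-identityˡ 1#
  broken-circuit-expansion {n} (suc m) G y = begin
    sumSubsets G (suc m) (forestTerm G y)
      ≈⟨ sumSubsets-∷ʳ G m _ (forestTerm-respects G y) ⟩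
    sumSubsets G m (λ ρ → forestTerm G y (ρ ∷ʳ true) + forestTerm G y (ρ ∷ʳ false))
      ≈⟨ sumSubsets-cong G m (forestTerm-∷ʳ G y) ⟩
    sumSubsets G m (λ ρ → (1# + yₘ) * forestTerm G⁻ y⁻ ρ)
      ≈⟨ *-distribˡ-sumSubsets G m _ _ ⟨
    (1# + yₘ) * sumSubsets G m (forestTerm G⁻ y⁻)
      ≈⟨ *-congˡ (reflexive (sumSubsets-graph-irrelevant G G⁻ m _)) ⟩
    (1# + yₘ) * sumSubsets G⁻ m (forestTerm G⁻ y⁻)
      ≈⟨ *-congˡ (broken-circuit-expansion m G⁻ y⁻) ⟩
    (1# + yₘ) * prodFin m (λ e → 1# + y⁻ e)
      ≈⟨ *-comm _ _ ⟩
    prodFin m (λ e → 1# + y⁻ e) * (1# + yₘ)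
      ≈⟨ prodFin-init-last m (λ e → 1# + y e) ⟨
    prodFin (suc m) (λ e → 1# + y e) ∎
    where
    G⁻ : Graph n m
    G⁻ = deleteLast G
    y⁻ : Fin m → Carrier
    y⁻ i = y (inject₁ i)
    yₘ : Carrier
    yₘ = y (Fin.fromℕ m)

module Colourings {c ℓ : Level} (R : CommutativeRing c ℓ) (q : ℕ) (qinv : CommutativeRing.Carrier R)
                  (q*qinv≈1 : CommutativeRing._≈_ R (CommutativeRing._*_ R (RingNotions.fromℕ R q) qinv) (CommutativeRing.1# R))
                  (a₀ : Fin q) where
  open CommutativeRing R hiding (zero)
  open RingNotions R
  open FiniteSums R
  open import Relation.Binary.Reasoning.Setoid setoid
  open CommSemigroupProps *-commutativeSemigroup using (x∙yz≈y∙xz)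

  𝔼 : (n : ℕ) → ((Fin n → Fin q) → Carrier) → Carrier
  𝔼 n g = qinv ^ᴿ n * sumMaps n q g

  𝔼-cong : ∀ n {f g : (Fin n → Fin q) → Carrier} → (∀ φ → f φ ≈ g φ) → 𝔼 n f ≈ 𝔼 n g
  𝔼-cong n f≈g = *-congˡ (sumMaps-cong n q f≈g)

  𝔼-suc : ∀ n g → 𝔼 (suc n) g ≈ qinv * sumFin q (λ a → 𝔼 n (λ φ → g (cons a φ)))
  𝔼-suc n g = trans (*-assoc _ _ _) (*-congˡ (*-distribˡ-sumFin q _ _))

  qinv*sumFin-const : ∀ a → qinv * sumFin q (λ _ → a) ≈ a
  qinv*sumFin-const a = begin
    qinv * sumFin q (λ _ → a)   ≈⟨ *-congˡ (sumFin-const q a) ⟩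
    qinv * (fromℕ q * a)        ≈⟨ *-assoc _ _ _ ⟨
    (qinv * fromℕ q) * a        ≈⟨ *-congʳ (trans (*-comm _ _) q*qinv≈1) ⟩
    1# * a                      ≈⟨ *-identityˡ a ⟩
    a                           ∎

  𝔼-suc-const : ∀ n g h → (∀ a φ → g (cons a φ) ≈ h φ) → 𝔼 (suc n) g ≈ 𝔼 n h
  𝔼-suc-const n g h g≈h = trans (𝔼-suc n g) (trans (*-congˡ (sumFin-cong q (λ a → 𝔼-cong n (g≈h a)))) (qinv*sumFin-const _))

  𝔼-1# : ∀ n → 𝔼 n (λ _ → 1#) ≈ 1#
  𝔼-1# zero    = *-identityˡ 1#
  𝔼-1# (suc n) = trans (𝔼-suc-const n (λ _ → 1#) (λ _ → 1#) (λ _ _ → refl)) (𝔼-1# n)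

  𝔼-0# : ∀ n → 𝔼 n (λ _ → 0#) ≈ 0#
  𝔼-0# n = begin
    qinv ^ᴿ n * sumMaps n q (λ _ → 0#)        ≈⟨ *-congˡ (sumMaps-cong n q (λ _ → zeroˡ 1#)) ⟨
    qinv ^ᴿ n * sumMaps n q (λ _ → 0# * 1#)   ≈⟨ *-congˡ (*-distribˡ-sumMaps n q 0# (λ _ → 1#)) ⟨
    qinv ^ᴿ n * (0# * sumMaps n q (λ _ → 1#)) ≈⟨ *-congˡ (zeroˡ _) ⟩
    qinv ^ᴿ n * 0#                            ≈⟨ zeroʳ _ ⟩
    0#                                        ∎

  DependsOn : ∀ {n} → (Fin n → Bool) → ((Fin n → Fin q) → Carrier) → Set _
  DependsOn {n} S g = ∀ φ ψ → (∀ v → S v ≡ true → φ v ≡ ψ v) → g φ ≈ g ψ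

  Disjoint : ∀ {n} → (Fin n → Bool) → (Fin n → Bool) → Set
  Disjoint S T = ∀ v → S v ≡ true → T v ≡ true → ⊥

  DependsOn-tail : ∀ {n} {S : Fin (suc n) → Bool} {g} a → DependsOn S g →
    DependsOn (λ v → S (suc v)) (λ φ → g (cons a φ))
  DependsOn-tail a dep φ ψ agree = dep _ _ λ { zero _ → ≡.refl ; (suc v) Sv → agree v Sv }

  DependsOn-not-head : ∀ {n} {S : Fin (suc n) → Bool} {g} → DependsOn S g → S zero ≡ false →
    ∀ a φ → g (cons a φ) ≈ g (cons a₀ φ)
  DependsOn-not-head dep S0 a φ = dep _ _ λ { zero S0′ → ⊥-elim (not-¬ S0′ S0) ; (suc v) _ → ≡.refl }

  Factorises : ℕ → Set _
  Factorises n = ∀ S T g h → Disjoint S T → DependsOn S g → DependsOn T h →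
                 𝔼 n (λ φ → g φ * h φ) ≈ 𝔼 n g * 𝔼 n h

  -- The first colour is averaged out in h alone, since g does not see it.
  Factorises-suc : ∀ n → Factorises n → ∀ S T g h → Disjoint S T → DependsOn S g → DependsOn T h →
    S zero ≡ false → 𝔼 (suc n) (λ φ → g φ * h φ) ≈ 𝔼 (suc n) g * 𝔼 (suc n) h
  Factorises-suc n factorises S T g h disjoint depS depT S0 = begin
    𝔼 (suc n) (λ φ → g φ * h φ)
      ≈⟨ 𝔼-suc n (λ φ → g φ * h φ) ⟩
    qinv * sumFin q (λ a → 𝔼 n (λ φ → g (cons a φ) * h (cons a φ)))
      ≈⟨ *-congˡ (sumFin-cong q λ a → 𝔼-cong n λ φ → *-congʳ (g-free a φ)) ⟩
    qinv * sumFin q (λ a → 𝔼 n (λ φ → g₀ φ * h (cons a φ)))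
      ≈⟨ *-congˡ (sumFin-cong q λ a → factorises _ _ _ _ (λ v → disjoint (suc v))
                                                (DependsOn-tail a₀ depS) (DependsOn-tail a depT)) ⟩
    qinv * sumFin q (λ a → 𝔼 n g₀ * 𝔼 n (λ φ → h (cons a φ)))
      ≈⟨ *-congˡ (*-distribˡ-sumFin q _ _) ⟨
    qinv * (𝔼 n g₀ * sumFin q (λ a → 𝔼 n (λ φ → h (cons a φ))))
      ≈⟨ x∙yz≈y∙xz _ _ _ ⟩
    𝔼 n g₀ * (qinv * sumFin q (λ a → 𝔼 n (λ φ → h (cons a φ))))
      ≈⟨ *-cong (𝔼-suc-const n g g₀ g-free) (𝔼-suc n h) ⟨
    𝔼 (suc n) g * 𝔼 (suc n) h ∎
    where
    g₀ : (Fin n → Fin q) → Carrier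
    g₀ φ = g (cons a₀ φ)
    g-free : ∀ a φ → g (cons a φ) ≈ g₀ φ
    g-free = DependsOn-not-head depS S0

  𝔼-*-independent : ∀ n → Factorises n
  𝔼-*-independent zero    S T g h _ _ _ = trans (*-identityˡ _) (sym (*-cong (*-identityˡ _) (*-identityˡ _)))
  𝔼-*-independent (suc n) S T g h disjoint depS depT with S zero in S0
  ... | false = Factorises-suc n (𝔼-*-independent n) S T g h disjoint depS depT S0
  ... | true  = begin
    𝔼 (suc n) (λ φ → g φ * h φ)
      ≈⟨ 𝔼-cong (suc n) (λ φ → *-comm (g φ) (h φ)) ⟩
    𝔼 (suc n) (λ φ → h φ * g φ)
      ≈⟨ Factorises-suc n (𝔼-*-independent n) T S h g (λ v Tv Sv → disjoint v Sv Tv) depT depS T0 ⟩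
    𝔼 (suc n) h * 𝔼 (suc n) g
      ≈⟨ *-comm _ _ ⟩
    𝔼 (suc n) g * 𝔼 (suc n) h ∎
    where
    T0 : T zero ≡ false
    T0 = ¬-not λ T0′ → disjoint zero S0 T0′

  PairwiseDisjoint : ∀ {n k} → (Fin k → Bool) → (Fin k → Fin n → Bool) → Set
  PairwiseDisjoint r V = ∀ i j v → r i ≡ true → r j ≡ true → V i v ≡ true → V j v ≡ true → i ≡ j

  PairwiseDisjoint-tail : ∀ {n k} {r : Fin (suc k) → Bool} {V : Fin (suc k) → Fin n → Bool} →
    PairwiseDisjoint r V → PairwiseDisjoint (λ i → r (suc i)) (λ i → V (suc i))
  PairwiseDisjoint-tail disjoint i j v ri rj Viv Vjv = Finₚ.suc-injective (disjoint (suc i) (suc j) v ri rj Viv Vjv)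

  𝔼-prodFin-independent : ∀ n k (r : Fin k → Bool) (V : Fin k → Fin n → Bool)
    (g : Fin k → (Fin n → Fin q) → Carrier) →
    (∀ i → r i ≡ true → DependsOn (V i) (g i)) → PairwiseDisjoint r V →
    𝔼 n (λ φ → prodFin k (λ i → if r i then g i φ else 1#)) ≈ prodFin k (λ i → if r i then 𝔼 n (g i) else 1#)
  𝔼-prodFin-independent n zero    r V g dep disjoint = 𝔼-1# n
  𝔼-prodFin-independent n (suc k) r V g dep disjoint with r zero in r0
  ... | false = trans (𝔼-cong n (λ φ → *-identityˡ _))
                      (trans (𝔼-prodFin-independent n k _ _ _ (λ i → dep (suc i)) (PairwiseDisjoint-tail disjoint))
                             (sym (*-identityˡ _)))
  ... | true  = trans (𝔼-*-independent n (V zero) U _ _ disjoint-head (dep zero r0) dep-rest)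
                      (*-congˡ (𝔼-prodFin-independent n k _ _ _ (λ i → dep (suc i)) (PairwiseDisjoint-tail disjoint)))
    where
    U : Fin n → Bool
    U v = anyFin k (λ j → r (suc j) ∧ V (suc j) v)
    disjoint-head : Disjoint (V zero) U
    disjoint-head v V0v Uv with anyFin⇒∃ k Uv
    ... | j , rj∧Vjv with ∧-elim {r (suc j)} rj∧Vjv
    ...   | rj , Vjv with disjoint zero (suc j) v r0 rj V0v Vjv
    ...     | ()
    dep-rest : DependsOn U (λ φ → prodFin k (λ i → if r (suc i) then g (suc i) φ else 1#))
    dep-rest φ ψ agree = prodFin-cong k (λ i → factor i (r (suc i)) ≡.refl)
      where
      factor : ∀ i b → r (suc i) ≡ b → (if b then g (suc i) φ else 1#) ≈ (if b then g (suc i) ψ else 1#)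
      factor i false _  = refl
      factor i true  ri = dep (suc i) ri φ ψ (λ v Vv → agree v (∃⇒anyFin k i (∧-intro ri Vv)))

  restrict : ∀ {n} → (Fin n → Bool) → (Fin n → Fin q) → Fin n → Maybe (Fin q)
  restrict S φ v = if S v then just (φ v) else nothing

  Respects≗ᴹ : ∀ n → ((Fin n → Maybe (Fin q)) → Carrier) → Set _
  Respects≗ᴹ n g = ∀ {ψ ψ′} → ψ ≗ ψ′ → g ψ ≈ g ψ′

  -- Colours outside S are averaged out, each contributing a factor qinv * q = 1.
  𝔼-restrict : ∀ n S g → Respects≗ᴹ n g → 𝔼 n (λ φ → g (restrict S φ)) ≈ qinv ^ᴿ count n S * sumMapsOn n q S g
  𝔼-restrict zero    S g resp = *-congˡ (resp (λ ()))
  𝔼-restrict (suc n) S g resp with S zero in S0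
  ... | true  = begin
    𝔼 (suc n) (λ φ → g (restrict S φ))
      ≈⟨ 𝔼-suc n (λ φ → g (restrict S φ)) ⟩
    qinv * sumFin q (λ a → 𝔼 n (λ φ → g (restrict S (cons a φ))))
      ≈⟨ *-congˡ (sumFin-cong q λ a → 𝔼-cong n λ φ → resp (restrict-cons a φ)) ⟩
    qinv * sumFin q (λ a → 𝔼 n (λ φ → g (cons (just a) (restrict S⁺ φ))))
      ≈⟨ *-congˡ (sumFin-cong q λ a → 𝔼-restrict n S⁺ _ (λ ψ≗ψ′ → resp (cons-cong (just a) ψ≗ψ′))) ⟩
    qinv * sumFin q (λ a → qinv ^ᴿ count n S⁺ * sumMapsOn n q S⁺ (λ ψ → g (cons (just a) ψ)))
      ≈⟨ *-congˡ (*-distribˡ-sumFin q _ _) ⟨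
    qinv * (qinv ^ᴿ count n S⁺ * sumFin q (λ a → sumMapsOn n q S⁺ (λ ψ → g (cons (just a) ψ))))
      ≈⟨ *-assoc _ _ _ ⟨
    qinv ^ᴿ suc (count n S⁺) * sumFin q (λ a → sumMapsOn n q S⁺ (λ ψ → g (cons (just a) ψ))) ∎
    where
    S⁺ : Fin n → Bool
    S⁺ v = S (suc v)
    restrict-cons : ∀ a φ → restrict S (cons a φ) ≗ cons (just a) (restrict S⁺ φ)
    restrict-cons a φ zero    rewrite S0 = ≡.refl
    restrict-cons a φ (suc v) = ≡.refl
  ... | false = begin
    𝔼 (suc n) (λ φ → g (restrict S φ))
      ≈⟨ 𝔼-suc-const n (λ φ → g (restrict S φ)) _ (λ a φ → resp (restrict-cons a φ)) ⟩
    𝔼 n (λ φ → g (cons nothing (restrict S⁺ φ)))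
      ≈⟨ 𝔼-restrict n S⁺ _ (λ ψ≗ψ′ → resp (cons-cong nothing ψ≗ψ′)) ⟩
    qinv ^ᴿ count n S⁺ * sumMapsOn n q S⁺ (λ ψ → g (cons nothing ψ)) ∎
    where
    S⁺ : Fin n → Bool
    S⁺ v = S (suc v)
    restrict-cons : ∀ a φ → restrict S (cons a φ) ≗ cons nothing (restrict S⁺ φ)
    restrict-cons a φ zero    rewrite S0 = ≡.refl
    restrict-cons a φ (suc v) = ≡.refl

module ForestWeights {c ℓ : Level} (R : CommutativeRing c ℓ) {n m : ℕ} (G : Graph n m) (q : ℕ)
    (qinv : CommutativeRing.Carrier R)
    (q*qinv≈1 : CommutativeRing._≈_ R (CommutativeRing._*_ R (RingNotions.fromℕ R q) qinv) (CommutativeRing.1# R))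
    (a₀ : Fin q) (A : Fin q → Fin q → CommutativeRing.Carrier R) (x : CommutativeRing.Carrier R) where
  open CommutativeRing R hiding (zero)
  open RingNotions R
  open FiniteSums R
  open Expansion R
  open Colourings R q qinv q*qinv≈1 a₀
  open Graph G
  open GraphNotions G
  open Walks G
  open Components G
  open import Relation.Binary.Reasoning.Setoid setoid

  y : (Fin n → Fin q) → Fin m → Carrier
  y φ e = x * (A (φ (src e)) (φ (tgt e)) - 1#)

  weight : EdgeSet m → Carrier
  weight = w G q qinv A x

  prodOver-congᵖ : ∀ S {h h′ : Fin m → Carrier} → (∀ f → S f ≡ true → h f ≈ h′ f) → prodOver G S h ≈ prodOver G S h′
  prodOver-congᵖ S h≈h′ = prodFin-cong m (λ f → factor f (S f) ≡.refl)
    where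
    factor : ∀ f b → S f ≡ b → (if b then _ else 1#) ≈ (if b then _ else 1#)
    factor f true  Sf = h≈h′ f Sf
    factor f false _  = refl

  if-*-distrib : ∀ b (u v : Carrier) → (if b then u * v else 1#) ≈ (if b then u else 1#) * (if b then v else 1#)
  if-*-distrib true  u v = refl
  if-*-distrib false u v = sym (*-identityˡ 1#)

  entry-restrict : ∀ (B : Mat q) V (φ : Fin n → Fin q) {s t} → V s ≡ true → V t ≡ true →
    entry B (restrict V φ s) (restrict V φ t) ≡ B (φ s) (φ t)
  entry-restrict B V φ Vs Vt rewrite Vs | Vt = ≡.refl

  module _ (F : EdgeSet m) (forest : Forest F) where
    T : Fin m → EdgeSet m
    T e = component F e

    V : Fin m → Fin n → Bool
    V e = vertexSet (T e)

    integrand : Fin m → (Fin n → Maybe (Fin q)) → Carrier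
    integrand e φ = x ^ᴿ count m (T e)
      * prodOver G (T e) (λ f → entry (A-J A) (φ (src f)) (φ (tgt f)))
      * prodOver G (brokenInduced (T e)) (λ f → entry (Jx x A) (φ (src f)) (φ (tgt f)))

    componentTerm : Fin m → (Fin n → Fin q) → Carrier
    componentTerm e φ = integrand e (restrict (V e) φ)

    integrand-respects : ∀ e → Respects≗ᴹ n (integrand e)
    integrand-respects e {ψ} {ψ′} ψ≗ψ′ = *-cong (*-congˡ (prodOver-congᵖ (T e) (λ f _ → same (A-J A) f)))
                                                (prodOver-congᵖ (brokenInduced (T e)) (λ f _ → same (Jx x A) f))
      where
      same : ∀ (B : Mat q) f → entry B (ψ (src f)) (ψ (tgt f)) ≈ entry B (ψ′ (src f)) (ψ′ (tgt f))
      same B f = reflexive (≡.cong₂ (entry B) (ψ≗ψ′ (src f)) (ψ≗ψ′ (tgt f)))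

    weight≈𝔼 : ∀ e → isRep F e ≡ true → weight (T e) ≈ 𝔼 n (componentTerm e)
    weight≈𝔼 e rep = sym (trans (𝔼-restrict n (V e) (integrand e) (integrand-respects e))
                                (reflexive (≡.cong (λ k → qinv ^ᴿ k * sumMapsOn n q (V e) (integrand e)) size)))
      where
      size : count n (V e) ≡ count m (T e) Nat.+ 1
      size = ≡.trans (component-vertex-count forest e (proj₁ (∧-elim rep))) (ℕₚ.+-comm 1 (count m (T e)))

    componentTerm-depends : ∀ e → DependsOn (V e) (componentTerm e)
    componentTerm-depends e φ ψ agree = integrand-respects e restrict-agree
      where
      restrict-agree : restrict (V e) φ ≗ restrict (V e) ψ
      restrict-agree v with V e v in Vv
      ... | true  = ≡.cong just (agree v Vv)
      ... | false = ≡.refl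

    components-disjoint : PairwiseDisjoint (isRep F) V
    components-disjoint i j v repi repj Viv Vjv =
      reps-disjoint F v repi repj
        (≡.trans (≡.sym (vertexSet-component F i (proj₁ (∧-elim repi)) v)) Viv)
        (≡.trans (≡.sym (vertexSet-component F j (proj₁ (∧-elim repj)) v)) Vjv)

    componentTerm≈ : ∀ e φ →
      componentTerm e φ ≈ prodOver G (T e) (y φ) * prodOver G (brokenInduced (T e)) (λ f → 1# + y φ f)
    componentTerm≈ e φ = *-cong (trans (*-congˡ (prodOver-congᵖ (T e) edge)) (^count*prodFin m x (T e) _))
                                (prodOver-congᵖ (brokenInduced (T e)) brokenEdge)
      where
      edge : ∀ f → T e f ≡ true →
        entry (A-J A) (restrict (V e) φ (src f)) (restrict (V e) φ (tgt f)) ≈ A (φ (src f)) (φ (tgt f)) - 1#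
      edge f Tf = reflexive (entry-restrict (A-J A) (V e) φ
                               (∃⇒anyFin m f (∧-intro Tf (∨-introˡ (tgt f == src f) (≡⇒== ≡.refl))))
                               (∃⇒anyFin m f (∧-intro Tf (∨-introʳ (src f == tgt f) (≡⇒== ≡.refl)))))
      brokenEdge : ∀ f → brokenInduced (T e) f ≡ true →
        entry (Jx x A) (restrict (V e) φ (src f)) (restrict (V e) φ (tgt f)) ≈ 1# + y φ f
      brokenEdge f bf = let srcIn , rest = ∧-elim bf in
        reflexive (entry-restrict (Jx x A) (V e) φ srcIn (proj₁ (∧-elim rest)))

    prodOver-components : ∀ φ → prodFin m (λ e → if isRep F e then componentTerm e φ else 1#) ≈
                                prodOver G F (y φ) * prodOver G (broken F) (λ f → 1# + y φ f)
    prodOver-components φ = begin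
      prodFin m (λ e → if isRep F e then componentTerm e φ else 1#)
        ≈⟨ prodFin-cong m (λ e → if-cong {isRep F e} ≡.refl (componentTerm≈ e φ) refl) ⟩
      prodFin m (λ e → if isRep F e then prodOver G (T e) (y φ) * prodOver G (brokenInduced (T e)) (λ f → 1# + y φ f) else 1#)
        ≈⟨ prodFin-cong m (λ e → if-*-distrib (isRep F e) _ _) ⟩
      prodFin m (λ e → (if isRep F e then prodOver G (T e) (y φ) else 1#) *
                       (if isRep F e then prodOver G (brokenInduced (T e)) (λ f → 1# + y φ f) else 1#))
        ≈⟨ prodFin-* m _ _ ⟩
      prodFin m (λ e → if isRep F e then prodOver G (T e) (y φ) else 1#) *
      prodFin m (λ e → if isRep F e then prodOver G (brokenInduced (T e)) (λ f → 1# + y φ f) else 1#)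
        ≈⟨ *-cong (prodFin-partition m m (isRep F) T F (y φ) (count-reps-component F))
                  (prodFin-partition m m (isRep F) (λ e → brokenInduced (T e)) (broken F) _ (count-reps-broken F)) ⟩
      prodOver G F (y φ) * prodOver G (broken F) (λ f → 1# + y φ f) ∎

    𝔼-forest : 𝔼 n (λ φ → prodOver G F (y φ) * prodOver G (broken F) (λ f → 1# + y φ f)) ≈
               prodOver G (isRep F) (λ e → weight (T e))
    𝔼-forest = begin
      𝔼 n (λ φ → prodOver G F (y φ) * prodOver G (broken F) (λ f → 1# + y φ f))
        ≈⟨ 𝔼-cong n (λ φ → sym (prodOver-components φ)) ⟩
      𝔼 n (λ φ → prodFin m (λ e → if isRep F e then componentTerm e φ else 1#))
        ≈⟨ 𝔼-prodFin-independent n m (isRep F) V componentTerm (λ e _ → componentTerm-depends e) components-disjoint ⟩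
      prodFin m (λ e → if isRep F e then 𝔼 n (componentTerm e) else 1#)
        ≈⟨ prodOver-congᵖ (isRep F) (λ e rep → sym (weight≈𝔼 e rep)) ⟩
      prodOver G (isRep F) (λ e → weight (T e)) ∎

  𝔼-forestTerm : ∀ F → 𝔼 n (λ φ → forestTerm G (y φ) F) ≈
                       (if isForest F then prodOver G (isRep F) (λ e → weight (component F e)) else 0#)
  𝔼-forestTerm F with isForest F in isF
  ... | true  = 𝔼-forest F (isForest⇒Forest isF)
  ... | false = 𝔼-0# n

  FG≈H : FG G weight ≈ H G q qinv A x
  FG≈H = sym (begin
    H G q qinv A x
      ≡⟨⟩
    𝔼 n (λ φ → prodFin m (λ e → 1# + y φ e))
      ≈⟨ 𝔼-cong n (λ φ → broken-circuit-expansion m G (y φ)) ⟨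
    qinv ^ᴿ n * sumMaps n q (λ φ → sumSubsets G m (forestTerm G (y φ)))
      ≈⟨ *-congˡ (sumMaps-sumSubsets G m n q _) ⟩
    qinv ^ᴿ n * sumSubsets G m (λ F → sumMaps n q (λ φ → forestTerm G (y φ) F))
      ≈⟨ *-distribˡ-sumSubsets G m _ _ ⟩
    sumSubsets G m (λ F → 𝔼 n (λ φ → forestTerm G (y φ) F))
      ≈⟨ sumSubsets-cong G m 𝔼-forestTerm ⟩
    FG G weight ∎)

open CommutativeRing using (Carrier; _≈_; _*_; 1#)
open RingNotions using (fromℕ; FG; w; H)

lemma6p1 : {c ℓ : Level} (R : CommutativeRing c ℓ) →
    {n m : ℕ} (G : Graph n m) (q : ℕ) → 2 ≤ q →
    (qinv : Carrier R) → _≈_ R (_*_ R (fromℕ R q) qinv) (1# R) →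
    (A : Fin q → Fin q → Carrier R) → (∀ a b → _≈_ R (A a b) (A b a)) →
    (x : Carrier R) →
    _≈_ R (FG R G (w R G q qinv A x)) (H R G q qinv A x)
lemma6p1 R G (suc q) _ qinv q*qinv≈1 A _ x = ForestWeights.FG≈H R G (suc q) qinv q*qinv≈1 zero A x
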